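{- Let $n\ge1$ and let $A\subseteq\omega$ be any set. The following are equivalent: (i) $\{Z\subseteq\omega: Z<_e A\}$ has a unique (up to the order of the ideals) proper covering by $n$ ideals; (ii) $\{Z\subseteq\omega:Z<_e A\}$ has a proper covering by $n$ ideals; (iii) $A$ is $n$-join irreducible and $(n-1)$-join reducible.
   Context: $\le_e$ is enumeration reducibility ($A=\Gamma(B)$ for some c.e. set $\Gamma$ of axioms $\langle x,D\rangle$, $D$ finite); $<_e$, $\equiv_e$ as usual; $X\oplus Y=\{2x:x\in X\}\cup\{2x+1:x\in Y\}$. In this statement sets range over all subsets of $\omega$. An ideal is a nonempty family of sets closed downward under $\le_e$ and closed under $\oplus$. A covering of $\{Z:Z<_e A\}$ by $n$ ideals is a list of ideals $\mathcal F_1,\dots,\mathcal F_n$ with $\bigcup_i\mathcal F_i=\{Z:Z<_e A\}$; it is proper if $\mathcal F_i\not\subseteq\mathcal F_j$ for all $i\ne j$. For $m\ge0$, $A$ is $m$-join irreducible if for all $A_0,\dots,A_m<_e A$ there are $i\ne j$ with $A_i\oplus A_j<_e A$, and $A$ is $m$-join reducible if it is not $m$-join irreducible (i.e. there are $A_0,\dots,A_m<_e A$ with $A_i\oplus A_j\equiv_e A$ for all $i\neq j$). -}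

module Defs where

open import Level using (0ℓ)
open import Data.Nat using (ℕ; zero; suc; _+_; _*_; _^_; _/_; _%_; _<_; _≤_; _∸_)
open import Data.Fin using (Fin)
open import Data.Vec using (Vec; []; _∷_; lookup)
open import Data.Maybe using (Maybe; just; nothing)
open import Data.Product using (Σ; _×_; _,_; ∃; proj₁; proj₂)
open import Data.Sum using (_⊎_)
open import Relation.Binary.PropositionalEquality using (_≡_; _≢_)
open import Relation.Nullary using (¬_)
open import Data.Fin.Permutation using (Permutation′; _⟨$⟩ʳ_)

data Code : ℕ → Set where
  zer  : ∀ {n} → Code n
  succ : Code 1
  proj : ∀ {n} → Fin n → Code n
  comp : ∀ {m n} → Code m → Vec (Code n) m → Code n
  prim : ∀ {n} → Code n → Code (suc (suc n)) → Code (suc n)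
  mu   : ∀ {n} → Code (suc n) → Code n

mutual
  eval : ∀ {n} → ℕ → Code n → Vec ℕ n → Maybe ℕ
  eval zero _ _ = nothing
  eval (suc k) zer xs = just 0
  eval (suc k) succ (x ∷ []) = just (suc x)
  eval (suc k) (proj i) xs = just (lookup xs i)
  eval (suc k) (comp f gs) xs with evalVec k gs xs
  ... | nothing = nothing
  ... | just ys = eval k f ys
  eval (suc k) (prim f g) (zero ∷ xs) = eval k f xs
  eval (suc k) (prim f g) (suc y ∷ xs) with eval k (prim f g) (y ∷ xs)
  ... | nothing = nothing
  ... | just r = eval k g (y ∷ r ∷ xs)
  eval (suc k) (mu f) xs = search k f 0 xs

  evalVec : ∀ {m n} → ℕ → Vec (Code n) m → Vec ℕ n → Maybe (Vec ℕ m)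
  evalVec k [] xs = just []
  evalVec k (g ∷ gs) xs with eval k g xs
  ... | nothing = nothing
  ... | just y with evalVec k gs xs
  ...   | nothing = nothing
  ...   | just ys = just (y ∷ ys)

  search : ∀ {n} → ℕ → Code (suc n) → ℕ → Vec ℕ n → Maybe ℕ
  search zero f start xs = nothing
  search (suc k) f start xs with eval k f (start ∷ xs)
  ... | nothing = nothing
  ... | just zero = just start
  ... | just (suc _) = search k f (suc start) xs

Halts : Code 1 → ℕ → Set
Halts c x = Σ ℕ λ fuel → Σ ℕ λ y → eval fuel c (x ∷ []) ≡ just y

SetΩ : Set₁
SetΩ = ℕ → Set

CE : SetΩ → Set
CE W = Σ (Code 1) λ c → ∀ x → (W x → Halts c x) × (Halts c x → W x)

-- Cantor-style enumeration of ℕ × ℕ along diagonals (a bijection ℕ → ℕ × ℕ)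
unpair : ℕ → ℕ × ℕ
unpair zero = 0 , 0
unpair (suc n) with unpair n
... | zero , b = suc b , 0
... | suc a , b = a , suc b

-- canonical finite sets: i ∈ D_u iff the i-th binary digit of u is 1
bit : ℕ → ℕ → ℕ
bit u zero = u % 2
bit u (suc i) = bit (u / 2) i

_∈D_ : ℕ → ℕ → Set
i ∈D u = bit u i ≡ 1

-- D_u ⊆ B  (all elements of D_u are < u)
_⊆D_ : ℕ → SetΩ → Set
u ⊆D B = ∀ i → i < suc u → i ∈D u → B i

-- Γ(B) for a set of axioms Γ; the axiom ⟨x , D_u⟩ is coded by the number n with unpair n = (x , u)
applyOp : SetΩ → SetΩ → SetΩ
applyOp Γ B x = Σ ℕ λ n → Γ n × (proj₁ (unpair n) ≡ x) × (proj₂ (unpair n) ⊆D B)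

_≤e_ : SetΩ → SetΩ → Set₁
A ≤e B = Σ SetΩ λ Γ → CE Γ × (∀ x → (A x → applyOp Γ B x) × (applyOp Γ B x → A x))

_<e_ : SetΩ → SetΩ → Set₁
A <e B = (A ≤e B) × ¬ (B ≤e A)

_≡e_ : SetΩ → SetΩ → Set₁
A ≡e B = (A ≤e B) × (B ≤e A)

_⊕_ : SetΩ → SetΩ → SetΩ
(X ⊕ Y) m = (Σ ℕ λ x → (m ≡ 2 * x) × X x) ⊎ (Σ ℕ λ x → (m ≡ suc (2 * x)) × Y x)

Family : Set₂
Family = SetΩ → Set₁

_⊆F_ : Family → Family → Set₁
F ⊆F G = ∀ X → F X → G X

_≐F_ : Family → Family → Set₁
F ≐F G = (F ⊆F G) × (G ⊆F F)

record Ideal (F : Family) : Set₂ where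
  field
    nonempty : Σ SetΩ F
    downward : ∀ X Y → X ≤e Y → F Y → F X
    join     : ∀ X Y → F X → F Y → F (X ⊕ Y)

record Covering (n : ℕ) (A : SetΩ) (F : Fin n → Family) : Set₂ where
  field
    ideals : ∀ i → Ideal (F i)
    covers : ∀ Z → (Z <e A → Σ (Fin n) λ i → F i Z) × (Σ (Fin n) (λ i → F i Z) → Z <e A)

ProperCovering : (n : ℕ) → SetΩ → (Fin n → Family) → Set₂
ProperCovering n A F = Covering n A F × (∀ i j → i ≢ j → ¬ (F i ⊆F F j))

HasProperCovering : ℕ → SetΩ → Set₂
HasProperCovering n A = Σ (Fin n → Family) λ F → ProperCovering n A F

HasUniqueProperCovering : ℕ → SetΩ → Set₂
HasUniqueProperCovering n A =
  HasProperCovering n A ×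
  (∀ F G → ProperCovering n A F → ProperCovering n A G →
     Σ (Permutation′ n) λ σ → ∀ i → F i ≐F G (σ ⟨$⟩ʳ i))

JoinIrreducible : ℕ → SetΩ → Set₁
JoinIrreducible m A =
  (As : Fin (suc m) → SetΩ) → (∀ i → As i <e A) →
  Σ (Fin (suc m)) λ i → Σ (Fin (suc m)) λ j → (i ≢ j) × ((As i ⊕ As j) <e A)

JoinReducible : ℕ → SetΩ → Set₁
JoinReducible m A = ¬ JoinIrreducible m A

-- Enumeration reducibility is a preorder with X ⊕ Y as least upper bound; the
-- reductions are built through Kleene's normal form, as Σ₁ sets of axioms.
--
-- In a proper covering of {Z | Z <e A} by ideals F 0, …, F (n-1), joining for
-- each j ≢ i a member of F i outside F j gives a set a i in F i and in no other
-- ideal. So a i ⊕ a j (i ≢ j) lies in no ideal, i.e. is not <e A: A is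
-- (n-1)-join reducible; n + 1 sets below A put two into one ideal, so A is
-- n-join irreducible; and any proper covering G matches F via F i = the ideal
-- of G containing a i. Conversely, from a 0, …, a (n-1) <e A with pairwise
-- joins ≡e A, n-join irreducibility makes {Z | Z ⊕ a i <e A} a proper covering.

module Submission where

open import Defs
open import Level using () renaming (suc to lsuc; zero to lzero)
open import Data.Nat using (ℕ; suc; _≤_; _∸_)
open import Data.Product using (_×_; _,_; proj₁; proj₂)
open import Function.Bundles using (_⇔_; mk⇔)
open import Axiom.ExcludedMiddle using (ExcludedMiddle)

module EvalMonotone where

  open import Defs
  open import Data.Nat
  open import Data.Nat.Properties
  open import Data.Vec using (Vec; []; _∷_)
  open import Data.Maybe using (Maybe; just; nothing)
  open import Relation.Binary.PropositionalEquality
  open import Data.Sum using (inj₁; inj₂)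
  open import Data.Maybe.Properties using (just-injective)

  mutual
    eval-suc : ∀ {n} k (c : Code n) xs {y} → eval k c xs ≡ just y → eval (suc k) c xs ≡ just y
    eval-suc zero c xs ()
    eval-suc (suc k) zer xs eq = eq
    eval-suc (suc k) succ (x ∷ []) eq = eq
    eval-suc (suc k) (proj i) xs eq = eq
    eval-suc (suc k) (comp f gs) xs eq with evalVec k gs xs in e
    eval-suc (suc k) (comp f gs) xs () | nothing
    ... | just ys rewrite evalVec-suc k gs xs e = eval-suc k f ys eq
    eval-suc (suc k) (prim f g) (zero ∷ xs) eq = eval-suc k f xs eq
    eval-suc (suc k) (prim f g) (suc y ∷ xs) eq with eval k (prim f g) (y ∷ xs) in e
    eval-suc (suc k) (prim f g) (suc y ∷ xs) () | nothing
    ... | just r rewrite eval-suc k (prim f g) (y ∷ xs) e = eval-suc k g _ eq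
    eval-suc (suc k) (mu f) xs eq = search-suc k f 0 xs eq

    evalVec-suc : ∀ {m n} k (gs : Vec (Code n) m) xs {ys} → evalVec k gs xs ≡ just ys → evalVec (suc k) gs xs ≡ just ys
    evalVec-suc k [] xs eq = eq
    evalVec-suc k (g ∷ gs) xs eq with eval k g xs in e1
    evalVec-suc k (g ∷ gs) xs () | nothing
    ... | just y with evalVec k gs xs in e2
    evalVec-suc k (g ∷ gs) xs () | just y | nothing
    ... | just ys rewrite eval-suc k g xs e1 | evalVec-suc k gs xs e2 = eq

    search-suc : ∀ {n} k (f : Code (suc n)) s xs {y} → search k f s xs ≡ just y → search (suc k) f s xs ≡ just y
    search-suc zero f s xs ()
    search-suc (suc k) f s xs eq with eval k f (s ∷ xs) in e
    search-suc (suc k) f s xs () | nothing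
    ... | just zero rewrite eval-suc k f (s ∷ xs) e = eq
    ... | just (suc _) rewrite eval-suc k f (s ∷ xs) e = search-suc k f (suc s) xs eq

  eval-mono : ∀ {n} {k k'} (c : Code n) xs {y} → k ≤ k' → eval k c xs ≡ just y → eval k' c xs ≡ just y
  eval-mono {k = k} {k'} c xs le eq with ≤⇒≤′ le
  ... | ≤′-refl = eq
  ... | ≤′-step {n = m} le' = eval-suc m c xs (eval-mono c xs (≤′⇒≤ le') eq)

  search-mono : ∀ {n} {k k'} (f : Code (suc n)) s xs {y} → k ≤ k' → search k f s xs ≡ just y → search k' f s xs ≡ just y
  search-mono {k = k} {k'} f s xs le eq with ≤⇒≤′ le
  ... | ≤′-refl = eq
  ... | ≤′-step {n = m} le' = search-suc m f s xs (search-mono f s xs (≤′⇒≤ le') eq)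

  eval-det : ∀ {n} {k k'} (c : Code n) xs {y y'} → eval k c xs ≡ just y → eval k' c xs ≡ just y' → y ≡ y'
  eval-det {k = k} {k'} c xs e1 e2 with ≤-total k k'
  ... | inj₁ le = just-injective (trans (sym (eval-mono c xs le e1)) e2)
  ... | inj₂ le = just-injective (trans (sym e1) (eval-mono c xs le e2))


module PrimRec where

  open import Defs
  open EvalMonotone
  open import Data.Nat
  open import Data.Nat.Properties
  open import Data.Fin using (Fin; zero; suc)
  open import Data.Vec using (Vec; []; _∷_; lookup; map)
  open import Data.Maybe using (just)
  open import Data.Product using (Σ; _,_; proj₁; proj₂)
  open import Relation.Binary.PropositionalEquality

  record PRF (n : ℕ) : Set where
    field
      code : Code n
      fn   : Vec ℕ n → ℕ
      ok   : ∀ xs → Σ ℕ λ k → eval k code xs ≡ just (fn xs)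
  open PRF public

  PRF-cong : ∀ {n} (p : PRF n) (h : Vec ℕ n → ℕ) → (∀ xs → fn p xs ≡ h xs) → PRF n
  PRF-cong p h e = record { code = code p ; fn = h ; ok = λ xs → proj₁ (ok p xs) , trans (proj₂ (ok p xs)) (cong just (e xs)) }

  ok-mono : ∀ {n} (p : PRF n) xs → Σ ℕ λ K → ∀ K' → K ≤ K' → eval K' (code p) xs ≡ just (fn p xs)
  ok-mono p xs = proj₁ (ok p xs) , λ K' le → eval-mono (code p) xs le (proj₂ (ok p xs))

  zeroP : ∀ {n} → PRF n
  zeroP = record { code = zer ; fn = λ _ → 0 ; ok = λ xs → 1 , refl }

  succP : PRF 1
  succP = record { code = succ ; fn = λ { (x ∷ []) → suc x } ; ok = λ { (x ∷ []) → 1 , refl } }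

  projP : ∀ {n} → Fin n → PRF n
  projP i = record { code = proj i ; fn = λ xs → lookup xs i ; ok = λ xs → 1 , refl }

  evalVec-ok : ∀ {m n} (gs : Vec (PRF n) m) xs → Σ ℕ λ K → ∀ K' → K ≤ K' →
        evalVec K' (map code gs) xs ≡ just (map (λ g → fn g xs) gs)
  evalVec-ok [] xs = 0 , λ K' _ → refl
  evalVec-ok (g ∷ gs) xs with ok-mono g xs | evalVec-ok gs xs
  ... | K1 , h1 | K2 , h2 = K1 ⊔ K2 , λ K' le → lem K' le
    where
    lem : ∀ K' → K1 ⊔ K2 ≤ K' → evalVec K' (map code (g ∷ gs)) xs ≡ just (map (λ g → fn g xs) (g ∷ gs))
    lem K' le rewrite h1 K' (≤-trans (m≤m⊔n K1 K2) le) | h2 K' (≤-trans (m≤n⊔m K1 K2) le) = refl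

  compP : ∀ {m n} → PRF m → Vec (PRF n) m → PRF n
  compP {m} {n} f gs = record { code = comp (code f) (map code gs) ; fn = λ xs → fn f (map (λ g → fn g xs) gs) ; ok = okc }
    where
    okc : ∀ xs → Σ ℕ λ k → eval k (comp (code f) (map code gs)) xs ≡ just (fn f (map (λ g → fn g xs) gs))
    okc xs with evalVec-ok gs xs | ok-mono f (map (λ g → fn g xs) gs)
    ... | K1 , h1 | K2 , h2 = suc (K1 ⊔ K2) , lem
      where
      lem : eval (suc (K1 ⊔ K2)) (comp (code f) (map code gs)) xs ≡ just (fn f (map (λ g → fn g xs) gs))
      lem rewrite h1 (K1 ⊔ K2) (m≤m⊔n K1 K2) = h2 (K1 ⊔ K2) (m≤n⊔m K1 K2)

  primP : ∀ {n} (f : PRF n) (g : PRF (suc (suc n))) (h : Vec ℕ (suc n) → ℕ) →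
          (∀ xs → h (0 ∷ xs) ≡ fn f xs) → (∀ y xs → h (suc y ∷ xs) ≡ fn g (y ∷ h (y ∷ xs) ∷ xs)) → PRF (suc n)
  primP {n} f g h h0 hs = record { code = prim (code f) (code g) ; fn = h ; ok = okp }
    where
    okp' : ∀ y xs → Σ ℕ λ K → ∀ K' → K ≤ K' → eval K' (prim (code f) (code g)) (y ∷ xs) ≡ just (h (y ∷ xs))
    okp' zero xs with ok-mono f xs
    ... | K , e = suc K , λ { (suc K') (s≤s le) → trans (e K' le) (cong just (sym (h0 xs))) }
    okp' (suc y) xs with okp' y xs | ok-mono g (y ∷ h (y ∷ xs) ∷ xs)
    ... | K1 , e1 | K2 , e2 = suc (K1 ⊔ K2) , lem
      where
      lem : ∀ K' → suc (K1 ⊔ K2) ≤ K' → eval K' (prim (code f) (code g)) (suc y ∷ xs) ≡ just (h (suc y ∷ xs))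
      lem (suc K') (s≤s le) rewrite e1 K' (≤-trans (m≤m⊔n K1 K2) le) =
        trans (e2 K' (≤-trans (m≤n⊔m K1 K2) le)) (cong just (sym (hs y xs)))
    okp : ∀ xs → Σ ℕ λ k → eval k (prim (code f) (code g)) xs ≡ just (h xs)
    okp (y ∷ xs) = proj₁ (okp' y xs) , proj₂ (okp' y xs) _ ≤-refl


module Expr where

  open import Defs
  open PrimRec
  open import Data.Nat
  open import Data.Nat.Properties
  open import Data.Fin using (Fin; zero; suc)
  open import Data.Vec using (Vec; []; _∷_; lookup; map)
  open import Relation.Binary.PropositionalEquality

  litP : ∀ {n} → ℕ → PRF n
  litP zero = zeroP
  litP (suc c) = compP succP (litP c ∷ [])

  litP-fn : ∀ {n} c (xs : Vec ℕ n) → fn (litP c) xs ≡ c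
  litP-fn zero xs = refl
  litP-fn (suc c) xs = cong suc (litP-fn c xs)

  addP : PRF 2
  addP = primP (projP zero) (compP succP (projP (suc zero) ∷ [])) (λ { (y ∷ x ∷ []) → y + x }) (λ { (x ∷ []) → refl }) (λ { y (x ∷ []) → refl })

  mulP : PRF 2
  mulP = primP zeroP (compP addP (projP (suc (suc zero)) ∷ projP (suc zero) ∷ [])) (λ { (y ∷ x ∷ []) → y * x }) (λ { (x ∷ []) → refl }) (λ { y (x ∷ []) → refl })

  predP : PRF 1
  predP = primP zeroP (projP zero) (λ { (y ∷ []) → pred y }) (λ { [] → refl }) (λ { y [] → refl })

  monusP : PRF 2
  monusP = primP (projP zero) (compP predP (projP (suc zero) ∷ [])) (λ { (y ∷ x ∷ []) → x ∸ y }) (λ { (x ∷ []) → refl }) (λ { y (x ∷ []) → sym (pred[m∸n]≡m∸[1+n] x y) })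

  infixl 6 _⊞_ _⊝_
  infixl 7 _⊛_

  data Ex (n : ℕ) : Set where
    var : Fin n → Ex n
    lit : ℕ → Ex n
    _⊞_ _⊛_ _⊝_ : Ex n → Ex n → Ex n
    ap : ∀ {m} → PRF m → Vec (Ex n) m → Ex n

  mutual
    ⟦_⟧ : ∀ {n} → Ex n → Vec ℕ n → ℕ
    ⟦ var i ⟧ xs = lookup xs i
    ⟦ lit c ⟧ xs = c
    ⟦ a ⊞ b ⟧ xs = ⟦ a ⟧ xs + ⟦ b ⟧ xs
    ⟦ a ⊛ b ⟧ xs = ⟦ a ⟧ xs * ⟦ b ⟧ xs
    ⟦ a ⊝ b ⟧ xs = ⟦ a ⟧ xs ∸ ⟦ b ⟧ xs
    ⟦ ap p es ⟧ xs = fn p (⟦ es ⟧V xs)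

    ⟦_⟧V : ∀ {n m} → Vec (Ex n) m → Vec ℕ n → Vec ℕ m
    ⟦ [] ⟧V xs = []
    ⟦ e ∷ es ⟧V xs = ⟦ e ⟧ xs ∷ ⟦ es ⟧V xs

  mutual
    toP : ∀ {n} → Ex n → PRF n
    toP (var i) = projP i
    toP (lit c) = litP c
    toP (a ⊞ b) = compP addP (toP a ∷ toP b ∷ [])
    toP (a ⊛ b) = compP mulP (toP a ∷ toP b ∷ [])
    toP (a ⊝ b) = compP monusP (toP b ∷ toP a ∷ [])
    toP (ap p es) = compP p (toPV es)

    toPV : ∀ {n m} → Vec (Ex n) m → Vec (PRF n) m
    toPV [] = []
    toPV (e ∷ es) = toP e ∷ toPV es

  mutual
    toP-ok : ∀ {n} (e : Ex n) xs → fn (toP e) xs ≡ ⟦ e ⟧ xs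
    toP-ok (var i) xs = refl
    toP-ok (lit c) xs = litP-fn c xs
    toP-ok (a ⊞ b) xs = cong₂ _+_ (toP-ok a xs) (toP-ok b xs)
    toP-ok (a ⊛ b) xs = cong₂ _*_ (toP-ok a xs) (toP-ok b xs)
    toP-ok (a ⊝ b) xs = cong₂ _∸_ (toP-ok a xs) (toP-ok b xs)
    toP-ok (ap p es) xs = cong (fn p) (toPV-ok es xs)

    toPV-ok : ∀ {n m} (es : Vec (Ex n) m) xs → map (λ g → fn g xs) (toPV es) ≡ ⟦ es ⟧V xs
    toPV-ok [] xs = refl
    toPV-ok (e ∷ es) xs = cong₂ _∷_ (toP-ok e xs) (toPV-ok es xs)

  prf : ∀ {n} → Ex n → PRF n
  prf e = PRF-cong (toP e) ⟦ e ⟧ (toP-ok e)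

  v0 : ∀ {n} → Ex (suc n)
  v0 = var zero
  v1 : ∀ {n} → Ex (suc (suc n))
  v1 = var (suc zero)
  v2 : ∀ {n} → Ex (suc (suc (suc n)))
  v2 = var (suc (suc zero))
  v3 : ∀ {n} → Ex (suc (suc (suc (suc n))))
  v3 = var (suc (suc (suc zero)))

  sgE : ∀ {n} → Ex n → Ex n
  sgE a = lit 1 ⊝ (lit 1 ⊝ a)

  sg : ℕ → ℕ
  sg x = 1 ∸ (1 ∸ x)


module StepFunction where

  open import Defs
  open PrimRec
  open Expr
  open import Data.Nat
  open import Data.Nat.Properties
  open import Data.Fin using (Fin; zero; suc; _↑ʳ_)
  open import Data.Vec using (Vec; []; _∷_; tabulate; _++_)
  open import Data.Vec.Properties using (lookup-++ʳ; tabulate∘lookup; tabulate-cong)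
  open import Data.Maybe using (Maybe; just; nothing)
  open import Data.Sum using (inj₁; inj₂)
  open import Data.Product using (_,_; _×_)
  open import Relation.Binary.PropositionalEquality

  enc : Maybe ℕ → ℕ
  enc nothing = 0
  enc (just y) = suc y

  -- Kleene's normal form: evaluation with the fuel as an extra argument (0 for
  -- out of fuel, y + 1 for the value y) is primitive recursive (fuelEvalPRF
  -- below), so every c.e. set is Σ₁ over a primitive recursive predicate.
  fuelEval : ∀ {n} → Code n → Vec ℕ (suc n) → ℕ
  fuelEval c (k ∷ xs) = enc (eval k c xs)

  shV : ∀ {n} p → Vec (Ex (p + n)) n
  shV p = tabulate (λ i → var (p ↑ʳ i))

  ⟦tab⟧ : ∀ {n m} (f : Fin m → Ex n) zs → ⟦ tabulate f ⟧V zs ≡ tabulate (λ i → ⟦ f i ⟧ zs)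
  ⟦tab⟧ {m = zero} f zs = refl
  ⟦tab⟧ {m = suc m} f zs = cong (⟦ f zero ⟧ zs ∷_) (⟦tab⟧ (λ i → f (suc i)) zs)

  shV-ok : ∀ {n p} (ys : Vec ℕ p) (xs : Vec ℕ n) → ⟦ shV p ⟧V (ys ++ xs) ≡ xs
  shV-ok {p = p} ys xs = trans (⟦tab⟧ (λ i → var (p ↑ʳ i)) (ys ++ xs))
    (trans (tabulate-cong (lookup-++ʳ ys xs)) (tabulate∘lookup xs))

  prodSg : ∀ {m} → Vec ℕ m → ℕ
  prodSg [] = 1
  prodSg (x ∷ xs) = sg x * prodSg xs

  predV : ∀ {m} → Vec ℕ m → Vec ℕ m
  predV [] = []
  predV (x ∷ xs) = (x ∸ 1) ∷ predV xs

  allE : ∀ {n m} → Vec (Ex n) m → Ex n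
  allE [] = lit 1
  allE (e ∷ es) = sgE e ⊛ allE es

  predsE : ∀ {n m} → Vec (Ex n) m → Vec (Ex n) m
  predsE [] = []
  predsE (e ∷ es) = (e ⊝ lit 1) ∷ predsE es

  allE-ok : ∀ {n m} (es : Vec (Ex n) m) zs → ⟦ allE es ⟧ zs ≡ prodSg (⟦ es ⟧V zs)
  allE-ok [] zs = refl
  allE-ok (e ∷ es) zs = cong (sg (⟦ e ⟧ zs) *_) (allE-ok es zs)

  predsE-ok : ∀ {n m} (es : Vec (Ex n) m) zs → ⟦ predsE es ⟧V zs ≡ predV (⟦ es ⟧V zs)
  predsE-ok [] zs = refl
  predsE-ok (e ∷ es) zs = cong ((⟦ e ⟧ zs ∸ 1) ∷_) (predsE-ok es zs)

  encs : ∀ {m n} → ℕ → Vec (Code n) m → Vec ℕ n → Vec ℕ m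
  encs k [] xs = []
  encs k (g ∷ gs) xs = enc (eval k g xs) ∷ encs k gs xs

  evalVec-nothing : ∀ {m n} k (gs : Vec (Code n) m) xs → evalVec k gs xs ≡ nothing → prodSg (encs k gs xs) ≡ 0
  evalVec-nothing k [] xs ()
  evalVec-nothing k (g ∷ gs) xs e with eval k g xs
  ... | nothing = refl
  ... | just y with evalVec k gs xs in e2
  evalVec-nothing k (g ∷ gs) xs () | just y | just _
  ... | nothing rewrite evalVec-nothing k gs xs e2 = *-zeroʳ (sg (suc y))

  evalVec-just : ∀ {m n} k (gs : Vec (Code n) m) xs {ys} → evalVec k gs xs ≡ just ys →
        (prodSg (encs k gs xs) ≡ 1) × (predV (encs k gs xs) ≡ ys)
  evalVec-just k [] xs refl = refl , refl
  evalVec-just k (g ∷ gs) xs e with eval k g xs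
  evalVec-just k (g ∷ gs) xs () | nothing
  ... | just y with evalVec k gs xs in e2
  evalVec-just k (g ∷ gs) xs () | just y | nothing
  evalVec-just k (g ∷ gs) xs refl | just y | just ys with evalVec-just k gs xs e2
  ... | p1 , p2 rewrite 0∸n≡0 y | p1 = refl , cong (y ∷_) p2

  fuelEval-comp : ∀ {m n} k (f : Code m) (gs : Vec (Code n) m) xs →
          prodSg (encs k gs xs) * enc (eval k f (predV (encs k gs xs))) ≡ enc (eval (suc k) (comp f gs) xs)
  fuelEval-comp k f gs xs with evalVec k gs xs in e
  ... | nothing rewrite evalVec-nothing k gs xs e = refl
  ... | just ys with evalVec-just k gs xs e
  ... | p1 , p2 rewrite p1 | p2 = +-identityʳ _

  -- prim f g at recursion argument j needs fuel growing with j; giving stage j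
  -- the fuel c + j turns its fuel-bounded evaluation into a recursion on j.
  Dfun : ∀ {n} → Code n → Code (suc (suc n)) → Vec ℕ (suc (suc n)) → ℕ
  Dfun f g (zero ∷ c ∷ xs) = sg c * enc (eval (c ∸ 1) f xs)
  Dfun f g (suc j ∷ c ∷ xs) = sg (Dfun f g (j ∷ c ∷ xs)) * enc (eval (c + j) g (j ∷ (Dfun f g (j ∷ c ∷ xs) ∸ 1) ∷ xs))

  Dfun-ok : ∀ {n} (f : Code n) g j c xs → Dfun f g (j ∷ c ∷ xs) ≡ enc (eval (c + j) (prim f g) (j ∷ xs))
  Dfun-ok f g zero zero xs = refl
  Dfun-ok f g zero (suc c) xs rewrite +-identityʳ c | 0∸n≡0 c = +-identityʳ _
  Dfun-ok f g (suc j) c xs rewrite +-suc c j | Dfun-ok f g j c xs with eval (c + j) (prim f g) (j ∷ xs)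
  ... | nothing = refl
  ... | just r rewrite 0∸n≡0 r = +-identityʳ _

  eval-prim-starved : ∀ {n} (f : Code n) g k y xs → k ≤ y → eval k (prim f g) (y ∷ xs) ≡ nothing
  eval-prim-starved f g zero y xs le = refl
  eval-prim-starved f g (suc k) (suc y) xs (s≤s le) rewrite eval-prim-starved f g k y xs le = refl

  fuelEval-prim : ∀ {n} (f : Code n) g k y xs → Dfun f g (y ∷ (k ∸ y) ∷ xs) ≡ enc (eval k (prim f g) (y ∷ xs))
  fuelEval-prim f g k y xs with ≤-total y k
  ... | inj₁ le rewrite Dfun-ok f g y (k ∸ y) xs | m∸n+n≡m le = refl
  ... | inj₂ le rewrite Dfun-ok f g y (k ∸ y) xs | m≤n⇒m∸n≡0 le
      | eval-prim-starved f g y y xs ≤-refl | eval-prim-starved f g k y xs le = refl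

  -- search k f s raises the candidate s while the fuel k decreases; Rfun
  -- recurses on the remaining fuel j and tests the candidate m ∸ j.
  Rfun : ∀ {n} → Code (suc n) → Vec ℕ (suc (suc n)) → ℕ
  Rfun f (zero ∷ m ∷ xs) = 0
  Rfun f (suc j ∷ m ∷ xs) =
    sg (enc (eval j f ((m ∸ (j + 1)) ∷ xs))) * (1 ∸ (enc (eval j f ((m ∸ (j + 1)) ∷ xs)) ∸ 1)) * ((m ∸ (j + 1)) + 1)
    + sg (enc (eval j f ((m ∸ (j + 1)) ∷ xs)) ∸ 1) * Rfun f (j ∷ m ∷ xs)

  ∸-sucʳ : ∀ m j → j < m → m ∸ j ≡ suc (m ∸ suc j)
  ∸-sucʳ (suc m) zero _ = refl
  ∸-sucʳ (suc m) (suc j) (s≤s lt) = ∸-sucʳ m j lt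

  Rfun-ok : ∀ {n} (f : Code (suc n)) j m xs → j ≤ m → Rfun f (j ∷ m ∷ xs) ≡ enc (search j f (m ∸ j) xs)
  Rfun-ok f zero m xs le = refl
  Rfun-ok f (suc j) m xs le rewrite +-comm j 1 with eval j f ((m ∸ suc j) ∷ xs)
  ... | nothing = refl
  ... | just zero = found-value (m ∸ suc j) (Rfun f (j ∷ m ∷ xs))
    where
    found-value : ∀ t R → 1 * 1 * (t + 1) + 0 * R ≡ suc t
    found-value t R rewrite *-identityˡ (t + 1) | +-identityʳ (t + 1) = +-comm t 1
  ... | just (suc w) rewrite Rfun-ok f j m xs (≤-trans (n≤1+n j) le) | ∸-sucʳ m j le | 0∸n≡0 w = +-identityʳ _

  mutual
    fuelEvalPRF : ∀ {n} → Code n → PRF (suc n)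
    fuelEvalPRF c = PRF-cong (body c) (fuelEval c) (body-ok c)

    argSteps : ∀ {m n} → Vec (Code n) m → Vec (Ex (suc n)) m
    argSteps [] = []
    argSteps (g ∷ gs) = ap (fuelEvalPRF g) ((v0 ⊝ lit 1) ∷ shV 1) ∷ argSteps gs

    DfunP : ∀ {n} → Code n → Code (suc (suc n)) → PRF (suc (suc n))
    DfunP f g = primP (prf (sgE v0 ⊛ ap (fuelEvalPRF f) ((v0 ⊝ lit 1) ∷ shV 1)))
                      (prf (sgE v1 ⊛ ap (fuelEvalPRF g) ((v2 ⊞ v0) ∷ v0 ∷ (v1 ⊝ lit 1) ∷ shV 3)))
                      (Dfun f g) (λ { (c ∷ xs) → Dfun-zero f c xs }) (λ { j (c ∷ xs) → Dfun-suc f g j c xs })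

    Dfun-zero : ∀ {n} (f : Code n) c xs → sg c * enc (eval (c ∸ 1) f xs) ≡ sg c * enc (eval (c ∸ 1) f (⟦ shV 1 ⟧V (c ∷ xs)))
    Dfun-zero f c xs rewrite shV-ok (c ∷ []) xs = refl

    Dfun-suc : ∀ {n} (f : Code n) g j c xs → Dfun f g (suc j ∷ c ∷ xs) ≡
          sg (Dfun f g (j ∷ c ∷ xs)) * enc (eval (c + j) g (j ∷ (Dfun f g (j ∷ c ∷ xs) ∸ 1) ∷ ⟦ shV 3 ⟧V (j ∷ Dfun f g (j ∷ c ∷ xs) ∷ c ∷ xs)))
    Dfun-suc f g j c xs rewrite shV-ok (j ∷ Dfun f g (j ∷ c ∷ xs) ∷ c ∷ []) xs = refl

    RfunP : ∀ {n} → Code (suc n) → PRF (suc (suc n))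
    RfunP f = primP zeroP (prf (sgE vE ⊛ (lit 1 ⊝ (vE ⊝ lit 1)) ⊛ (tE ⊞ lit 1) ⊞ sgE (vE ⊝ lit 1) ⊛ v1))
                  (Rfun f) (λ { (m ∷ xs) → refl }) (λ { j (m ∷ xs) → Rfun-suc f j m xs })
      where
      tE : Ex _
      tE = v2 ⊝ (v0 ⊞ lit 1)
      vE : Ex _
      vE = ap (fuelEvalPRF f) (v0 ∷ tE ∷ shV 3)

    Rfun-suc : ∀ {n} (f : Code (suc n)) j m xs → Rfun f (suc j ∷ m ∷ xs) ≡
      sg (enc (eval j f ((m ∸ (j + 1)) ∷ ⟦ shV 3 ⟧V (j ∷ Rfun f (j ∷ m ∷ xs) ∷ m ∷ xs)))) * (1 ∸ (enc (eval j f ((m ∸ (j + 1)) ∷ ⟦ shV 3 ⟧V (j ∷ Rfun f (j ∷ m ∷ xs) ∷ m ∷ xs))) ∸ 1)) * ((m ∸ (j + 1)) + 1)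
      + sg (enc (eval j f ((m ∸ (j + 1)) ∷ ⟦ shV 3 ⟧V (j ∷ Rfun f (j ∷ m ∷ xs) ∷ m ∷ xs))) ∸ 1) * Rfun f (j ∷ m ∷ xs)
    Rfun-suc f j m xs rewrite shV-ok (j ∷ Rfun f (j ∷ m ∷ xs) ∷ m ∷ []) xs = refl

    body : ∀ {n} → Code n → PRF (suc n)
    body zer = prf (sgE v0)
    body succ = prf (sgE v0 ⊛ (lit 2 ⊞ v1))
    body (proj i) = prf (sgE v0 ⊛ (lit 1 ⊞ var (suc i)))
    body (comp f gs) = prf (sgE v0 ⊛ allE (argSteps gs) ⊛ ap (fuelEvalPRF f) ((v0 ⊝ lit 1) ∷ predsE (argSteps gs)))
    body (prim f g) = prf (ap (DfunP f g) (v1 ∷ (v0 ⊝ v1) ∷ shV 2))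
    body (mu f) = prf (sgE v0 ⊛ ap (RfunP f) ((v0 ⊝ lit 1) ∷ (v0 ⊝ lit 1) ∷ shV 1))

    argSteps-ok : ∀ {m n} (gs : Vec (Code n) m) k xs → ⟦ argSteps gs ⟧V (k ∷ xs) ≡ encs (k ∸ 1) gs xs
    argSteps-ok [] k xs = refl
    argSteps-ok (g ∷ gs) k xs rewrite shV-ok (k ∷ []) xs = cong (enc (eval (k ∸ 1) g xs) ∷_) (argSteps-ok gs k xs)

    body-ok : ∀ {n} (c : Code n) xs → fn (body c) xs ≡ fuelEval c xs
    body-ok zer (zero ∷ xs) = refl
    body-ok zer (suc k ∷ xs) rewrite 0∸n≡0 k = refl
    body-ok succ (zero ∷ x ∷ []) = refl
    body-ok succ (suc k ∷ x ∷ []) rewrite 0∸n≡0 k = +-identityʳ _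
    body-ok (proj i) (zero ∷ xs) = refl
    body-ok (proj i) (suc k ∷ xs) rewrite 0∸n≡0 k = +-identityʳ _
    body-ok (comp f gs) (zero ∷ xs) = refl
    body-ok (comp f gs) (suc k ∷ xs) rewrite allE-ok (argSteps gs) (suc k ∷ xs) | predsE-ok (argSteps gs) (suc k ∷ xs) | argSteps-ok gs (suc k) xs | 0∸n≡0 k
      = trans (cong (_* enc (eval k f (predV (encs k gs xs)))) (*-identityˡ (prodSg (encs k gs xs)))) (fuelEval-comp k f gs xs)
    body-ok (prim f g) (k ∷ y ∷ xs) rewrite shV-ok (k ∷ y ∷ []) xs = fuelEval-prim f g k y xs
    body-ok (mu f) (zero ∷ xs) = refl
    body-ok (mu f) (suc k ∷ xs) rewrite shV-ok (suc k ∷ []) xs | Rfun-ok f k k xs ≤-refl | n∸n≡0 k | 0∸n≡0 k = +-identityʳ _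


module Sigma1 where

  open import Defs
  open EvalMonotone
  open PrimRec
  open StepFunction
  open import Data.Nat
  open import Data.Nat.Properties
  open import Data.Fin using (zero; suc)
  open import Data.Vec using ([]; _∷_)
  open import Data.Maybe using (Maybe; just; nothing)
  open import Data.Product using (Σ; _,_; proj₁; proj₂)
  open import Relation.Binary.PropositionalEquality

  search-sound : ∀ {n} (f : PRF (suc n)) k s xs {r} → search k (code f) s xs ≡ just r → fn f (r ∷ xs) ≡ 0
  search-sound f zero s xs ()
  search-sound f (suc k) s xs eq with eval k (code f) (s ∷ xs) in e
  search-sound f (suc k) s xs () | nothing
  search-sound f (suc k) s xs refl | just zero = sym (eval-det {k = k} {k' = proj₁ (ok f (s ∷ xs))} (code f) (s ∷ xs) e (proj₂ (ok f (s ∷ xs))))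
  ... | just (suc _) = search-sound f k (suc s) xs eq

  search-complete : ∀ {n} (f : PRF (suc n)) d s xs → fn f ((d + s) ∷ xs) ≡ 0 → Σ ℕ λ k → Σ ℕ λ r → search k (code f) s xs ≡ just r
  search-complete f d s xs z with ok-mono f (s ∷ xs) | fn f (s ∷ xs) in ev
  ... | K , h | zero = suc K , s , lem
    where
    lem : search (suc K) (code f) s xs ≡ just s
    lem rewrite h K ≤-refl | ev = refl
  search-complete f zero s xs z | K , h | suc w = ⊥-elim' (trans (sym ev) z)
    where
    ⊥-elim' : suc w ≡ 0 → _
    ⊥-elim' ()
  search-complete f (suc d) s xs z | K , h | suc w with search-complete f d (suc s) xs (trans (cong (λ t → fn f (t ∷ xs)) (+-suc d s)) z)
  ... | K2 , r , h2 = suc (K ⊔ K2) , r , lem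
    where
    lem : search (suc (K ⊔ K2)) (code f) s xs ≡ just r
    lem rewrite h (K ⊔ K2) (m≤m⊔n K K2) | ev = search-mono (code f) (suc s) xs (m≤n⊔m K K2) h2

  Σ₁ : PRF 2 → SetΩ
  Σ₁ f x = Σ ℕ λ y → fn f (y ∷ x ∷ []) ≡ 0

  Σ₁-CE : ∀ f → CE (Σ₁ f)
  Σ₁-CE f = mu (code f) , λ x → to x , from x
    where
    to : ∀ x → Σ₁ f x → Halts (mu (code f)) x
    to x (y , z) with search-complete f y 0 (x ∷ []) (trans (cong (λ t → fn f (t ∷ x ∷ [])) (+-identityʳ y)) z)
    ... | k , r , h = suc k , r , h
    from : ∀ x → Halts (mu (code f)) x → Σ₁ f x
    from x (zero , y , ())
    from x (suc k , y , h) = y , search-sound f k 0 (x ∷ []) h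

  halts⇒fuelEval : ∀ (c : Code 1) m → Halts c m → Σ ℕ λ s → 1 ∸ fuelEval c (s ∷ m ∷ []) ≡ 0
  halts⇒fuelEval c m (s , y , h) = s , trans (cong (λ t → 1 ∸ enc t) h) (0∸n≡0 y)

  fuelEval⇒halts : ∀ (c : Code 1) m s → 1 ∸ fuelEval c (s ∷ m ∷ []) ≡ 0 → Halts c m
  fuelEval⇒halts c m s h with eval s c (m ∷ []) in e
  fuelEval⇒halts c m s () | nothing
  ... | just y = s , y , e

  fuelEval-halts-mono : ∀ (c : Code 1) m s s' → s ≤ s' → 1 ∸ fuelEval c (s ∷ m ∷ []) ≡ 0 → 1 ∸ fuelEval c (s' ∷ m ∷ []) ≡ 0
  fuelEval-halts-mono c m s s' le h with eval s c (m ∷ []) in e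
  fuelEval-halts-mono c m s s' le () | nothing
  ... | just y rewrite eval-mono c (m ∷ []) le e = 0∸n≡0 y


module Coding where

  open import Defs
  open PrimRec
  open Expr
  open StepFunction using (shV; shV-ok)
  open import Data.Nat
  open import Data.Nat.Properties
  open import Data.Nat.DivMod
  open import Data.Nat.Tactic.RingSolver
  open import Data.Fin using (zero; suc)
  open import Data.Vec using ([]; _∷_)
  open import Data.Bool using (Bool; true; false)
  open import Data.Product using (Σ; _,_; proj₁; proj₂; _×_)
  open import Data.Sum using (_⊎_; inj₁; inj₂)
  open import Data.Empty using (⊥-elim)
  open import Relation.Binary.PropositionalEquality
  open import Relation.Binary.Definitions using (tri<; tri≈; tri>)
  open import Function using (_∘_)

  parF : ℕ → ℕ
  parF zero = 0
  parF (suc y) = 1 ∸ parF y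

  halfF : ℕ → ℕ
  halfF zero = 0
  halfF (suc y) = halfF y + parF y

  parF≤1 : ∀ y → parF y ≤ 1
  parF≤1 zero = z≤n
  parF≤1 (suc y) = m∸n≤m 1 (parF y)

  par+ : ∀ y → parF y + (1 ∸ parF y) ≡ 1
  par+ y with parF y | parF≤1 y
  ... | zero | _ = refl
  ... | suc zero | _ = refl
  ... | suc (suc _) | s≤s ()

  par% : ∀ y → parF y ≡ y % 2
  par% zero = refl
  par% (suc zero) = refl
  par% (suc (suc y)) with parF y | parF≤1 y | par% y
  ... | zero | _ | e = e
  ... | suc zero | _ | e = e
  ... | suc (suc _) | s≤s () | _

  half/ : ∀ y → halfF y ≡ y / 2
  half/ zero = refl
  half/ (suc zero) = refl
  half/ (suc (suc y)) = begin
      halfF y + parF y + (1 ∸ parF y) ≡⟨ +-assoc (halfF y) _ _ ⟩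
      halfF y + (parF y + (1 ∸ parF y)) ≡⟨ cong (halfF y +_) (par+ y) ⟩
      halfF y + 1 ≡⟨ +-comm (halfF y) 1 ⟩
      suc (halfF y) ≡⟨ cong suc (half/ y) ⟩
      suc (y / 2) ≡⟨ sym (Data.Nat.DivMod.Core.divₕ-extractAcc 1 1 y 1) ⟩
      suc (suc y) / 2 ∎
    where open ≡-Reasoning
          import Data.Nat.DivMod.Core

  halvings : ℕ → ℕ → ℕ
  halvings zero u = u
  halvings (suc i) u = halfF (halvings i u)

  halvings-half : ∀ i u → halvings i (halfF u) ≡ halfF (halvings i u)
  halvings-half zero u = refl
  halvings-half (suc i) u = cong halfF (halvings-half i u)

  bit≡ : ∀ u i → bit u i ≡ parF (halvings i u)
  bit≡ u zero = sym (par% u)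
  bit≡ u (suc i) = begin
    bit (u / 2) i          ≡⟨ bit≡ (u / 2) i ⟩
    parF (halvings i (u / 2))    ≡⟨ cong (parF ∘ halvings i) (sym (half/ u)) ⟩
    parF (halvings i (halfF u))  ≡⟨ cong parF (halvings-half i u) ⟩
    parF (halvings (suc i) u)    ∎
    where open ≡-Reasoning

  bit01 : ∀ u i → bit u i ≡ 0 ⊎ bit u i ≡ 1
  bit01 u i rewrite bit≡ u i with parF (halvings i u) | parF≤1 (halvings i u)
  ... | zero | _ = inj₁ refl
  ... | suc zero | _ = inj₂ refl
  ... | suc (suc _) | s≤s ()

  parP : PRF 1
  parP = primP zeroP (prf (lit 1 ⊝ v1)) (λ { (y ∷ []) → parF y }) (λ { [] → refl }) (λ { y [] → refl })

  halfP : PRF 1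
  halfP = primP zeroP (prf (v1 ⊞ ap parP (v0 ∷ []))) (λ { (y ∷ []) → halfF y }) (λ { [] → refl }) (λ { y [] → refl })

  halvingsP : PRF 2
  halvingsP = primP (projP zero) (prf (ap halfP (v1 ∷ []))) (λ { (i ∷ u ∷ []) → halvings i u }) (λ { (u ∷ []) → refl }) (λ { i (u ∷ []) → refl })

  bitP : PRF 2
  bitP = PRF-cong (prf (ap parP (ap halvingsP (v1 ∷ v0 ∷ []) ∷ []))) (λ { (u ∷ i ∷ []) → bit u i }) (λ { (u ∷ i ∷ []) → sym (bit≡ u i) })

  bit-bound : ∀ u i → bit u i ≡ 1 → i < u
  bit-bound u zero e with u
  ... | zero = case0 e
    where case0 : 0 % 2 ≡ 1 → 0 < 0
          case0 ()
  ... | suc u' = s≤s z≤n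
  bit-bound u (suc i) e = lem (bit-bound (u / 2) i e)
    where
    lem : i < u / 2 → suc i < u
    lem lt = ≤-trans (q i) (≤-trans (*-monoʳ-≤ 2 lt) (≤-trans (≤-reflexive (*-comm 2 (u / 2))) (m/n*n≤m u 2)))
      where
      q : ∀ i → suc (suc i) ≤ 2 * suc i
      q i = s≤s (subst (suc i ≤_) (sym (+-suc i (i + 0))) (s≤s (m≤m+n i (i + 0))))

  b2n : Bool → ℕ
  b2n false = 0
  b2n true = 1

  fromB : ℕ → (ℕ → Bool) → ℕ
  fromB zero p = 0
  fromB (suc N) p = b2n (p 0) + fromB N (λ i → p (suc i)) * 2

  b2n≤1 : ∀ b → b2n b ≤ 1
  b2n≤1 false = z≤n
  b2n≤1 true = s≤s z≤n

  mod-lem : ∀ c k → c ≤ 1 → (c + k * 2) % 2 ≡ c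
  mod-lem c k le = trans ([m+kn]%n≡m%n c k 2) (m≤n⇒m%n≡m le)

  div-lem : ∀ c k → c ≤ 1 → (c + k * 2) / 2 ≡ k
  div-lem c k le = trans (+-distrib-/ c (k * 2) (subst (λ t → c % 2 + t < 2) (sym (m*n%n≡0 k 2)) (subst (λ t → t + 0 < 2) (sym (m≤n⇒m%n≡m le)) (s≤s (≤-trans (≤-reflexive (+-identityʳ c)) le)))))
    (trans (cong₂ _+_ (m<n⇒m/n≡0 (s≤s le)) (m*n/n≡m k 2)) refl)

  bit-fromB : ∀ N p i → bit (fromB N p) i ≡ 1 → (i < N) × (p i ≡ true)
  bit-fromB zero p zero ()
  bit-fromB zero p (suc i) e with bit-fromB zero p i e
  ... | () , _
  bit-fromB (suc N) p zero e with p 0 in ep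
  ... | true = s≤s z≤n , refl
  ... | false = ⊥-elim (0≢1 (trans (sym (mod-lem 0 (fromB N (λ i → p (suc i))) z≤n)) e))
    where 0≢1 : 0 ≢ 1
          0≢1 ()
  bit-fromB (suc N) p (suc i) e rewrite div-lem (b2n (p 0)) (fromB N (λ i → p (suc i))) (b2n≤1 (p 0))
    with bit-fromB N (λ i → p (suc i)) i e
  ... | lt , q = s≤s lt , q

  fromB-bit : ∀ N p i → i < N → p i ≡ true → bit (fromB N p) i ≡ 1
  fromB-bit (suc N) p zero lt q rewrite q = mod-lem 1 (fromB N (λ i → p (suc i))) (s≤s z≤n)
  fromB-bit (suc N) p (suc i) (s≤s lt) q rewrite div-lem (b2n (p 0)) (fromB N (λ i → p (suc i))) (b2n≤1 (p 0)) = fromB-bit N (λ i → p (suc i)) i lt q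

  -- unpair enumerates the Cantor code (a + b)(a + b + 1)/2 + b, doubled here to
  -- avoid the division.
  twicePair : ℕ → ℕ → ℕ
  twicePair a b = (a + b) * (a + b + 1) + 2 * b

  unpair-F : ∀ m → 2 * m ≡ twicePair (proj₁ (unpair m)) (proj₂ (unpair m))
  unpair-F zero = refl
  unpair-F (suc m) with unpair m | unpair-F m
  ... | zero , b | ih = trans (*-suc 2 m) (trans (cong (2 +_) ih) (next-diagonal b))
    where next-diagonal : ∀ b → 2 + ((0 + b) * (0 + b + 1) + 2 * b) ≡ (suc b + 0) * (suc b + 0 + 1) + 2 * 0
          next-diagonal = solve-∀
  ... | suc a , b | ih = trans (*-suc 2 m) (trans (cong (2 +_) ih) (along-diagonal a b))
    where along-diagonal : ∀ a b → 2 + ((suc a + b) * (suc a + b + 1) + 2 * b) ≡ (a + suc b) * (a + suc b + 1) + 2 * suc b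
          along-diagonal = solve-∀

  triangle-suc : ∀ d → suc d * (suc d + 1) ≡ suc (suc (d * (d + 1) + 2 * d))
  triangle-suc = solve-∀

  twicePair-< : ∀ a b a' b' → a + b < a' + b' → twicePair a b < twicePair a' b'
  twicePair-< a b a' b' lt = ≤-trans below-next-diagonal (≤-trans diagonal-mono (m≤m+n _ _))
    where
    d = a + b
    d' = a' + b'
    below-next-diagonal : suc (twicePair a b) ≤ (suc d) * (suc d + 1)
    below-next-diagonal = ≤-trans (s≤s (+-monoʳ-≤ (d * (d + 1)) (*-monoʳ-≤ 2 (m≤n+m b a)))) (≤-trans (n≤1+n _) (≤-reflexive (sym (triangle-suc d))))
    diagonal-mono : (suc d) * (suc d + 1) ≤ d' * (d' + 1)
    diagonal-mono = *-mono-≤ lt (+-monoˡ-≤ 1 lt)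

  twicePair-injective : ∀ a b a' b' → twicePair a b ≡ twicePair a' b' → (a ≡ a') × (b ≡ b')
  twicePair-injective a b a' b' e with <-cmp (a + b) (a' + b')
  ... | tri< lt _ _ = ⊥-elim (<-irrefl e (twicePair-< a b a' b' lt))
  ... | tri> _ _ gt = ⊥-elim (<-irrefl (sym e) (twicePair-< a' b' a b gt))
  ... | tri≈ _ de _ = a≡ , b≡
    where
    b≡ : b ≡ b'
    b≡ = *-cancelˡ-≡ b b' 2 (+-cancelˡ-≡ ((a + b) * (a + b + 1)) _ _ (trans e (cong (λ t → t * (t + 1) + 2 * b') (sym de))))
    a≡ : a ≡ a'
    a≡ = +-cancelʳ-≡ b a a' (trans de (cong (a' +_) (sym b≡)))

  unpair-char : ∀ m a b → 2 * m ≡ twicePair a b → unpair m ≡ (a , b)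
  unpair-char m a b e with twicePair-injective _ _ _ _ (trans (sym (unpair-F m)) e)
  ... | e1 , e2 = cong₂ _,_ e1 e2

  unpair-surj : ∀ a b → Σ ℕ λ n → unpair n ≡ (a , b)
  unpair-surj a b = S (a + b) b a refl
    where
    S : ∀ k b a → a + b ≡ k → Σ ℕ λ n → unpair n ≡ (a , b)
    S k zero zero _ = 0 , refl
    S zero zero (suc a) ()
    S (suc k) zero (suc a) e with S k a 0 (trans (sym (+-identityʳ a)) (cong pred e))
    ... | m , em = suc m , lem
      where lem : unpair (suc m) ≡ (suc a , 0)
            lem rewrite em = refl
    S k (suc b) a e with S k b (suc a) (trans (sym (+-suc a b)) e)
    ... | m , em = suc m , lem
      where lem : unpair (suc m) ≡ (a , suc b)
            lem rewrite em = refl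


module Bounded where

  open import Defs
  open PrimRec
  open Expr
  open StepFunction using (shV; shV-ok)
  open import Data.Nat
  open import Data.Nat.Properties
  open import Data.Fin using (zero; suc)
  open import Data.Vec using ([]; _∷_)
  open import Data.Product using (Σ; _,_; _×_)
  open import Data.Sum using (_⊎_; inj₁; inj₂)
  open import Relation.Binary.PropositionalEquality

  -- Predicates are coded by their zero sets: + is conjunction, * disjunction,
  -- and bounded sums and products are bounded ∀ and ∃.
  bsumF : (ℕ → ℕ) → ℕ → ℕ
  bsumF g zero = 0
  bsumF g (suc b) = bsumF g b + g b

  bprodF : (ℕ → ℕ) → ℕ → ℕ
  bprodF g zero = 1
  bprodF g (suc b) = bprodF g b * g b

  bsumP : ∀ {n} → PRF (suc n) → PRF (suc n)
  bsumP p = primP zeroP (prf (v1 ⊞ ap p (v0 ∷ shV 2))) (λ { (b ∷ xs) → bsumF (λ i → fn p (i ∷ xs)) b })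
    (λ xs → refl) (λ { b xs → cong (λ t → bsumF (λ i → fn p (i ∷ xs)) b + fn p (b ∷ t)) (sym (shV-ok (b ∷ bsumF (λ i → fn p (i ∷ xs)) b ∷ []) xs)) })

  bprodP : ∀ {n} → PRF (suc n) → PRF (suc n)
  bprodP p = primP (prf (lit 1)) (prf (v1 ⊛ ap p (v0 ∷ shV 2))) (λ { (b ∷ xs) → bprodF (λ i → fn p (i ∷ xs)) b })
    (λ xs → refl) (λ { b xs → cong (λ t → bprodF (λ i → fn p (i ∷ xs)) b * fn p (b ∷ t)) (sym (shV-ok (b ∷ bprodF (λ i → fn p (i ∷ xs)) b ∷ []) xs)) })

  ALL : ∀ {n} → Ex n → Ex (suc n) → Ex n
  ALL b body = ap (bsumP (prf body)) (b ∷ shV 0)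

  EX : ∀ {n} → Ex n → Ex (suc n) → Ex n
  EX b body = ap (bprodP (prf body)) (b ∷ shV 0)

  ALL-sem : ∀ {n} (b : Ex n) body xs → ⟦ ALL b body ⟧ xs ≡ bsumF (λ i → ⟦ body ⟧ (i ∷ xs)) (⟦ b ⟧ xs)
  ALL-sem b body xs rewrite shV-ok [] xs = refl

  EX-sem : ∀ {n} (b : Ex n) body xs → ⟦ EX b body ⟧ xs ≡ bprodF (λ i → ⟦ body ⟧ (i ∷ xs)) (⟦ b ⟧ xs)
  EX-sem b body xs rewrite shV-ok [] xs = refl

  bsum-sound : ∀ g b → bsumF g b ≡ 0 → ∀ i → i < b → g i ≡ 0
  bsum-sound g (suc b) e i lt with m<1+n⇒m<n∨m≡n lt
  ... | inj₁ lt' = bsum-sound g b (m+n≡0⇒m≡0 _ e) i lt'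
  ... | inj₂ refl = m+n≡0⇒n≡0 (bsumF g b) e

  bsum-comp : ∀ g b → (∀ i → i < b → g i ≡ 0) → bsumF g b ≡ 0
  bsum-comp g zero h = refl
  bsum-comp g (suc b) h rewrite bsum-comp g b (λ i lt → h i (m<n⇒m<1+n lt)) = h b ≤-refl

  bprod-sound : ∀ g b → bprodF g b ≡ 0 → Σ ℕ λ i → i < b × g i ≡ 0
  bprod-sound g zero ()
  bprod-sound g (suc b) e with m*n≡0⇒m≡0∨n≡0 (bprodF g b) e
  ... | inj₂ z = b , ≤-refl , z
  ... | inj₁ z with bprod-sound g b z
  ... | i , lt , z' = i , m<n⇒m<1+n lt , z'

  bprod-comp : ∀ g b i → i < b → g i ≡ 0 → bprodF g b ≡ 0
  bprod-comp g (suc b) i lt z with m<1+n⇒m<n∨m≡n lt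
  ... | inj₁ lt' rewrite bprod-comp g b i lt' z = refl
  ... | inj₂ refl rewrite z = *-zeroʳ (bprodF g b)

  ALL-sound : ∀ {n} (b : Ex n) body xs → ⟦ ALL b body ⟧ xs ≡ 0 → ∀ i → i < ⟦ b ⟧ xs → ⟦ body ⟧ (i ∷ xs) ≡ 0
  ALL-sound b body xs e = bsum-sound _ _ (trans (sym (ALL-sem b body xs)) e)

  ALL-comp : ∀ {n} (b : Ex n) body xs → (∀ i → i < ⟦ b ⟧ xs → ⟦ body ⟧ (i ∷ xs) ≡ 0) → ⟦ ALL b body ⟧ xs ≡ 0
  ALL-comp b body xs h = trans (ALL-sem b body xs) (bsum-comp _ _ h)

  EX-sound : ∀ {n} (b : Ex n) body xs → ⟦ EX b body ⟧ xs ≡ 0 → Σ ℕ λ i → i < ⟦ b ⟧ xs × ⟦ body ⟧ (i ∷ xs) ≡ 0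
  EX-sound b body xs e = bprod-sound _ _ (trans (sym (EX-sem b body xs)) e)

  EX-comp : ∀ {n} (b : Ex n) body xs i → i < ⟦ b ⟧ xs → ⟦ body ⟧ (i ∷ xs) ≡ 0 → ⟦ EX b body ⟧ xs ≡ 0
  EX-comp b body xs i lt z = trans (EX-sem b body xs) (bprod-comp _ _ i lt z)

  EQ : ∀ {n} → Ex n → Ex n → Ex n
  EQ a b = (a ⊝ b) ⊞ (b ⊝ a)

  eq-sound : ∀ x y → (x ∸ y) + (y ∸ x) ≡ 0 → x ≡ y
  eq-sound x y e = ≤-antisym (m∸n≡0⇒m≤n (m+n≡0⇒m≡0 _ e)) (m∸n≡0⇒m≤n (m+n≡0⇒n≡0 (x ∸ y) e))

  eq-comp : ∀ x → (x ∸ x) + (x ∸ x) ≡ 0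
  eq-comp x rewrite n∸n≡0 x = refl

  +0 : ∀ x y → x + y ≡ 0 → (x ≡ 0) × (y ≡ 0)
  +0 x y e = m+n≡0⇒m≡0 x e , m+n≡0⇒n≡0 x e

  *0 : ∀ x y → x * y ≡ 0 → (x ≡ 0) ⊎ (y ≡ 0)
  *0 x y e = m*n≡0⇒m≡0∨n≡0 x e



module ManyOne where

  open import Defs
  open PrimRec
  open Expr
  open StepFunction using (fuelEval; fuelEvalPRF)
  open Sigma1
  open Coding
  open Bounded
  open import Data.Nat
  open import Data.Nat.Properties
  open import Data.Fin using (zero; suc)
  open import Data.Vec using ([]; _∷_)
  open import Data.Bool using (Bool; true)
  open import Data.Product using (_,_; proj₁; proj₂)
  open import Data.Sum using (inj₁; inj₂)
  open import Data.Empty using (⊥; ⊥-elim)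
  open import Relation.Binary.PropositionalEquality

  PAIR : ∀ {n} → Ex n → Ex n → Ex n → Ex n
  PAIR m a b = EQ (lit 2 ⊛ m) ((a ⊞ b) ⊛ (a ⊞ b ⊞ lit 1) ⊞ lit 2 ⊛ b)

  pair-sound : ∀ m a b → (2 * m ∸ twicePair a b) + (twicePair a b ∸ 2 * m) ≡ 0 → unpair m ≡ (a , b)
  pair-sound m a b e = unpair-char m a b (eq-sound _ _ e)

  pair-comp : ∀ m a b → unpair m ≡ (a , b) → (2 * m ∸ twicePair a b) + (twicePair a b ∸ 2 * m) ≡ 0
  pair-comp m a b e rewrite sym (cong₂ twicePair (cong proj₁ e) (cong proj₂ e)) | sym (unpair-F m) = eq-comp (2 * m)

  BIT1 : ∀ {n} → Ex n → Ex n → Ex n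
  BIT1 u i = lit 1 ⊝ ap bitP (u ∷ i ∷ [])

  bit1-sound : ∀ u i → 1 ∸ bit u i ≡ 0 → bit u i ≡ 1
  bit1-sound u i e with bit01 u i
  ... | inj₂ b = b
  ... | inj₁ b rewrite b = ⊥-elim (case e)
    where case : 1 ≡ 0 → ⊥
          case ()

  bit1-comp : ∀ u i → bit u i ≡ 1 → 1 ∸ bit u i ≡ 0
  bit1-comp u i e rewrite e = refl

  single : ℕ → ℕ
  single k = fromB (suc k) (λ i → i ≡ᵇ k)

  single-bit : ∀ k → bit (single k) k ≡ 1
  single-bit k = fromB-bit (suc k) (λ i → i ≡ᵇ k) k ≤-refl (rf k)
    where rf : ∀ k → (k ≡ᵇ k) ≡ true
          rf zero = refl
          rf (suc k) = rf k

  single-only : ∀ k i → bit (single k) i ≡ 1 → i ≡ k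
  single-only k i e = ≡ᵇ⇒≡ i k (subst Data.Bool.T (sym (proj₂ (bit-fromB (suc k) (λ i → i ≡ᵇ k) i e))) _)
    where import Data.Bool

  -- Every reduction is given as the Σ₁ set of axiom codes n with P (y ∷ n) ≡ 0
  -- for some y, where all bounded quantifiers of P range below that one y.
  manyOne⇒≤e : (h : PRF 1) (X Z : SetΩ) → (∀ x → X x → Z (fn h (x ∷ []))) → (∀ x → Z (fn h (x ∷ [])) → X x) → X ≤e Z
  manyOne⇒≤e h X Z to from = Σ₁ (prf P) , Σ₁-CE (prf P) , λ x → fwd x , bwd x
    where
    B2 : Ex 4
    B2 = PAIR v3 v1 v0 ⊞ BIT1 v0 (ap h (v1 ∷ []))
    B1 : Ex 3
    B1 = EX v1 B2
    P : Ex 2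
    P = EX v0 B1
    bwd : ∀ x → applyOp (Σ₁ (prf P)) Z x → X x
    bwd x0 (n , (y , t) , e1 , sub) with EX-sound v0 B1 (y ∷ n ∷ []) t
    ... | x , _ , t2 with EX-sound v1 B2 (x ∷ y ∷ n ∷ []) t2
    ... | u , _ , t3 with +0 _ _ t3
    ... | tp , tb with pair-sound n x u tp
    ... | eu = subst X (trans (sym (cong proj₁ eu)) e1) (from x (sub (fn h (x ∷ [])) (≤-trans (bit-bound _ _ bb') (n≤1+n _)) bb'))
      where bb = bit1-sound u (fn h (x ∷ [])) tb
            bb' : bit (proj₂ (unpair n)) (fn h (x ∷ [])) ≡ 1
            bb' = subst (λ w → bit w (fn h (x ∷ [])) ≡ 1) (sym (cong proj₂ eu)) bb
    fwd : ∀ x → X x → applyOp (Σ₁ (prf P)) Z x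
    fwd x0 Xx with unpair-surj x0 (single (fn h (x0 ∷ [])))
    ... | n , en = n , (suc (x0 + u) , t) , cong proj₁ en , sub
      where
      u = single (fn h (x0 ∷ []))
      sub : proj₂ (unpair n) ⊆D Z
      sub i lt bi rewrite en | single-only (fn h (x0 ∷ [])) i bi = to x0 Xx
      t : ⟦ P ⟧ (suc (x0 + u) ∷ n ∷ []) ≡ 0
      t = EX-comp v0 B1 (suc (x0 + u) ∷ n ∷ []) x0 (s≤s (m≤m+n x0 u)) (EX-comp v1 B2 (x0 ∷ suc (x0 + u) ∷ n ∷ []) u (s≤s (m≤n+m u x0))
            (cong₂ _+_ (pair-comp n x0 u en) (bit1-comp u (fn h (x0 ∷ [])) (single-bit (fn h (x0 ∷ []))))))

  ≤e-refl : ∀ {X} → X ≤e X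
  ≤e-refl {X} = manyOne⇒≤e (prf v0) X X (λ x p → p) (λ x p → p)

  ≤e-⊕l : ∀ {X Y} → X ≤e (X ⊕ Y)
  ≤e-⊕l {X} {Y} = manyOne⇒≤e (prf (lit 2 ⊛ v0)) X (X ⊕ Y) (λ x p → inj₁ (x , refl , p)) from
    where
    from : ∀ x → (X ⊕ Y) (2 * x) → X x
    from x (inj₁ (x' , e , p)) = subst X (sym (*-cancelˡ-≡ x x' 2 e)) p
    from x (inj₂ (x' , e , p)) = ⊥-elim (even≢odd x x' e)

  ≤e-⊕r : ∀ {X Y} → Y ≤e (X ⊕ Y)
  ≤e-⊕r {X} {Y} = manyOne⇒≤e (prf (lit 1 ⊞ lit 2 ⊛ v0)) Y (X ⊕ Y) (λ x p → inj₂ (x , refl , p)) from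
    where
    from : ∀ x → (X ⊕ Y) (suc (2 * x)) → Y x
    from x (inj₂ (x' , e , p)) = subst Y (sym (*-cancelˡ-≡ x x' 2 (cong pred e))) p
    from x (inj₁ (x' , e , p)) = ⊥-elim (even≢odd x' x (sym e))


module Join where

  open import Defs
  open Expr
  open StepFunction using (fuelEval; fuelEvalPRF)
  open Sigma1
  open Coding
  open Bounded
  open ManyOne
  open import Data.Nat
  open import Data.Nat.Properties
  open import Data.Fin using (suc; #_)
  open import Data.Vec using ([]; _∷_)
  open import Data.Product using (_,_; proj₁; proj₂)
  open import Data.Sum using (inj₁; inj₂)
  open import Relation.Binary.PropositionalEquality

  HALT : ∀ {n} → Code 1 → Ex n → Ex n → Ex n
  HALT c s m = lit 1 ⊝ ap (fuelEvalPRF c) (s ∷ m ∷ [])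

  prod0l : ∀ a b → a ≡ 0 → a * b ≡ 0
  prod0l a b e rewrite e = refl

  prod0r : ∀ a b → b ≡ 0 → a * b ≡ 0
  prod0r a b e rewrite e = *-zeroʳ a

  module JoinAxioms {X Y Z ΓX ΓY : SetΩ} (cX cY : Code 1)
    (hX : ∀ m → (ΓX m → Halts cX m) × (Halts cX m → ΓX m))
    (hY : ∀ m → (ΓY m → Halts cY m) × (Halts cY m → ΓY m))
    (eX : ∀ x → (X x → applyOp ΓX Z x) × (applyOp ΓX Z x → X x))
    (eY : ∀ x → (Y x → applyOp ΓY Z x) × (applyOp ΓY Z x → Y x)) where

    fromX fromY choice : Ex 6
    fromX = EQ v3 (lit 2 ⊛ v1) ⊞ HALT cX (var (# 4)) v0
    fromY = EQ v3 (lit 1 ⊞ lit 2 ⊛ v1) ⊞ HALT cY (var (# 4)) v0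
    choice = fromX ⊛ fromY
    B4 : Ex 6
    B4 = PAIR (var (# 5)) v3 v2 ⊞ PAIR v0 v1 v2 ⊞ choice
    B3 : Ex 5
    B3 = EX (var (# 3)) B4
    B2 : Ex 4
    B2 = EX v2 B3
    B1 : Ex 3
    B1 = EX v1 B2
    P : Ex 2
    P = EX v0 B1

    join-sound : ∀ x → applyOp (Σ₁ (prf P)) Z x → (X ⊕ Y) x
    join-sound x0 (n , (y , t) , e1 , sub) with EX-sound v0 B1 (y ∷ n ∷ []) t
    ... | x , _ , t1 with EX-sound v1 B2 (x ∷ y ∷ n ∷ []) t1
    ... | u , _ , t2 with EX-sound v2 B3 (u ∷ x ∷ y ∷ n ∷ []) t2
    ... | x' , _ , t3 with EX-sound (var (# 3)) B4 (x' ∷ u ∷ x ∷ y ∷ n ∷ []) t3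
    ... | m , _ , t4 with +0 _ _ t4
    ... | t5 , t6 with +0 _ _ t5
    ... | tp1 , tp2 with pair-sound n x u tp1 | pair-sound m x' u tp2
    ... | en | em = subst (X ⊕ Y) (trans (sym (cong proj₁ en)) e1) (cases (*0 _ _ t6))
      where
      subu : u ⊆D Z
      subu = subst (_⊆D Z) (cong proj₂ en) sub
      app : ∀ {Γ : SetΩ} → Γ m → applyOp Γ Z x'
      app g = m , g , cong proj₁ em , subst (_⊆D Z) (sym (cong proj₂ em)) subu
      cases : _ → (X ⊕ Y) x
      cases (inj₁ z) with +0 _ _ z
      ... | q1 , q2 = inj₁ (x' , eq-sound _ _ q1 , proj₂ (eX x') (app (proj₂ (hX m) (fuelEval⇒halts cX m y q2))))
      cases (inj₂ z) with +0 _ _ z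
      ... | q1 , q2 = inj₂ (x' , eq-sound _ _ q1 , proj₂ (eY x') (app (proj₂ (hY m) (fuelEval⇒halts cY m y q2))))

    join-complete-via : ∀ x0 x' m s → proj₁ (unpair m) ≡ x' → proj₂ (unpair m) ⊆D Z →
      (∀ n y → s ≤ y → ⟦ choice ⟧ (m ∷ x' ∷ proj₂ (unpair m) ∷ x0 ∷ y ∷ n ∷ []) ≡ 0) →
      applyOp (Σ₁ (prf P)) Z x0
    join-complete-via x0 x' m s e1 sub chosen with unpair-surj x0 (proj₂ (unpair m))
    ... | n , en = n , (suc S , t) , cong proj₁ en , subst (_⊆D Z) (sym (cong proj₂ en)) sub
      where
      u = proj₂ (unpair m)
      S = x0 + u + x' + m + s
      L0 = suc S ∷ n ∷ []
      t : ⟦ P ⟧ L0 ≡ 0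
      t = EX-comp v0 B1 L0 x0 (s≤s (m≤n⇒m≤n+o s (m≤n⇒m≤n+o m (m≤n⇒m≤n+o x' (m≤m+n x0 u)))))
           (EX-comp v1 B2 (x0 ∷ L0) u (s≤s (m≤n⇒m≤n+o s (m≤n⇒m≤n+o m (m≤n⇒m≤n+o x' (m≤n+m u x0)))))
           (EX-comp v2 B3 (u ∷ x0 ∷ L0) x' (s≤s (m≤n⇒m≤n+o s (m≤n⇒m≤n+o m (m≤n+m x' (x0 + u)))))
           (EX-comp (var (# 3)) B4 (x' ∷ u ∷ x0 ∷ L0) m (s≤s (m≤n⇒m≤n+o s (m≤n+m m (x0 + u + x'))))
           (cong₂ _+_ (cong₂ _+_ (pair-comp n x0 u en) (pair-comp m x' u (cong (_, u) e1)))
                      (chosen n (suc S) (≤-trans (m≤n+m s _) (n≤1+n _)))))))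

    join-complete : ∀ x → (X ⊕ Y) x → applyOp (Σ₁ (prf P)) Z x
    join-complete x0 (inj₁ (x' , refl , Xx')) with proj₁ (eX x') Xx'
    ... | m , g , e1 , sub with halts⇒fuelEval cX m (proj₁ (hX m) g)
    ... | s , hs = join-complete-via x0 x' m s e1 sub λ n y s≤y →
          prod0l _ _ (cong₂ _+_ (eq-comp (2 * x')) (fuelEval-halts-mono cX m s y s≤y hs))
    join-complete x0 (inj₂ (x' , refl , Yx')) with proj₁ (eY x') Yx'
    ... | m , g , e1 , sub with halts⇒fuelEval cY m (proj₁ (hY m) g)
    ... | s , hs = join-complete-via x0 x' m s e1 sub λ n y s≤y →
          prod0r (⟦ fromX ⟧ (m ∷ x' ∷ proj₂ (unpair m) ∷ suc (2 * x') ∷ y ∷ n ∷ [])) _ (cong₂ _+_ (eq-comp (suc (2 * x'))) (fuelEval-halts-mono cY m s y s≤y hs))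

  ≤e-lub : ∀ {X Y Z} → X ≤e Z → Y ≤e Z → (X ⊕ Y) ≤e Z
  ≤e-lub (ΓX , (cX , hX) , eX) (ΓY , (cY , hY) , eY) =
    Σ₁ (prf P) , Σ₁-CE (prf P) , λ x → join-complete x , join-sound x
    where open JoinAxioms cX cY hX hY eX eY


module Composition where

  open import Defs
  open Expr
  open StepFunction using (fuelEval; fuelEvalPRF)
  open Sigma1
  open Coding
  open Bounded
  open ManyOne
  open Join using (HALT)
  open import Level using (Lift; lift)
  open import Axiom.ExcludedMiddle using (ExcludedMiddle)
  open import Data.Nat
  open import Data.Nat.Properties
  open import Data.Fin using (zero; suc; #_)
  open import Data.Vec using ([]; _∷_)
  open import Data.Bool using (Bool; true)
  open import Data.Product using (Σ; _,_; proj₁; proj₂; _×_)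
  open import Data.Sum using (inj₁; inj₂)
  open import Data.Empty using (⊥-elim)
  open import Relation.Nullary using (Dec; yes; no; does)
  open import Relation.Binary.PropositionalEquality

  IMP : ∀ {n} → Ex n → Ex n → Ex n
  IMP p q = (lit 1 ⊝ p) ⊛ q

  imp-sound : ∀ w i q → bit w i ≡ 1 → (1 ∸ (1 ∸ bit w i)) * q ≡ 0 → q ≡ 0
  imp-sound w i q b e rewrite b = trans (sym (+-identityʳ q)) e

  imp-comp : ∀ w i q → (bit w i ≡ 1 → q ≡ 0) → (1 ∸ (1 ∸ bit w i)) * q ≡ 0
  imp-comp w i q h with bit01 w i
  ... | inj₁ b rewrite b = refl
  ... | inj₂ b rewrite h b = *-zeroʳ (1 ∸ (1 ∸ bit w i))

  collect : ∀ (P : ℕ → Set) (Pd : ∀ e → Dec (P e)) (Q : ℕ → ℕ → Set) →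
            (∀ e b b' → b ≤ b' → Q e b → Q e b') → ∀ K →
            (∀ e → e < K → P e → Σ ℕ (Q e)) → Σ ℕ λ B → ∀ e → e < K → P e → Q e B
  collect P Pd Q mono zero h = 0 , λ e ()
  collect P Pd Q mono (suc K) h with collect P Pd Q mono K (λ e lt p → h e (m<n⇒m<1+n lt) p) | Pd K
  ... | B1 , h1 | no ¬p = B1 , λ e lt p → case e lt p
    where
    case : ∀ e → e < suc K → P e → Q e B1
    case e lt p with m<1+n⇒m<n∨m≡n lt
    ... | inj₁ lt' = h1 e lt' p
    ... | inj₂ refl = ⊥-elim (¬p p)
  ... | B1 , h1 | yes pK with h K ≤-refl pK
  ... | b , q = B1 ⊔ b , λ e lt p → case e lt p
    where
    case : ∀ e → e < suc K → P e → Q e (B1 ⊔ b)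
    case e lt p with m<1+n⇒m<n∨m≡n lt
    ... | inj₁ lt' = mono e B1 _ (m≤m⊔n B1 b) (h1 e lt' p)
    ... | inj₂ refl = mono e b _ (m≤n⊔m B1 b) q

  module Composite {A B C Γ Δ : SetΩ} (cG cD : Code 1)
    (hG : ∀ m → (Γ m → Halts cG m) × (Halts cG m → Γ m))
    (hD : ∀ m → (Δ m → Halts cD m) × (Halts cD m → Δ m))
    (eA : ∀ x → (A x → applyOp Γ B x) × (applyOp Γ B x → A x))
    (eB : ∀ x → (B x → applyOp Δ C x) × (applyOp Δ C x → B x)) where

    C4 : Ex 10
    C4 = IMP (BIT1 v2 v0) (BIT1 (var (# 6)) v0)
    C3 : Ex 9
    C3 = PAIR v0 v2 v1 ⊞ HALT cD (var (# 7)) v0 ⊞ ALL (lit 1 ⊞ v1) C4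
    C2 : Ex 8
    C2 = EX (var (# 6)) C3
    C1 : Ex 7
    C1 = IMP (BIT1 v2 v0) (EX (var (# 5)) C2)
    B4 : Ex 6
    B4 = PAIR (var (# 5)) v3 v2 ⊞ PAIR v0 v3 v1 ⊞ HALT cG (var (# 4)) v0 ⊞ ALL (lit 1 ⊞ v1) C1
    B3 : Ex 5
    B3 = EX (var (# 3)) B4
    B2 : Ex 4
    B2 = EX v2 B3
    B1 : Ex 3
    B1 = EX v1 B2
    P : Ex 2
    P = EX v0 B1

    composite-sound : ∀ x → applyOp (Σ₁ (prf P)) C x → A x
    composite-sound x0 (n , (y , t) , e1 , sub) with EX-sound v0 B1 (y ∷ n ∷ []) t
    ... | x , _ , t1 with EX-sound v1 B2 (x ∷ y ∷ n ∷ []) t1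
    ... | u , _ , t2 with EX-sound v2 B3 (u ∷ x ∷ y ∷ n ∷ []) t2
    ... | v , _ , t3 with EX-sound (var (# 3)) B4 (v ∷ u ∷ x ∷ y ∷ n ∷ []) t3
    ... | m , _ , t4 with +0 _ _ t4
    ... | t5 , tall with +0 _ _ t5
    ... | t6 , thalt with +0 _ _ t6
    ... | tp1 , tp2 with pair-sound n x u tp1 | pair-sound m x v tp2
    ... | en | emm = subst A (trans (sym (cong proj₁ en)) e1) (proj₂ (eA x) (m , proj₂ (hG m) (fuelEval⇒halts cG m y thalt) , cong proj₁ emm , subst (_⊆D B) (sym (cong proj₂ emm)) subv))
      where
      ctx4 = m ∷ v ∷ u ∷ x ∷ y ∷ n ∷ []
      subu : u ⊆D C
      subu = subst (_⊆D C) (cong proj₂ en) sub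
      subv : v ⊆D B
      subv e lt be with EX-sound (var (# 5)) C2 (e ∷ ctx4) (imp-sound v e _ be (ALL-sound (lit 1 ⊞ v1) C1 ctx4 tall e lt))
      ... | w , _ , c2 with EX-sound (var (# 6)) C3 (w ∷ e ∷ ctx4) c2
      ... | m' , _ , c3 with +0 _ _ c3
      ... | c4 , call with +0 _ _ c4
      ... | cp , ch with pair-sound m' e w cp
      ... | em' = proj₂ (eB e) (m' , proj₂ (hD m') (fuelEval⇒halts cD m' y ch) , cong proj₁ em' , subst (_⊆D C) (sym (cong proj₂ em')) subw)
        where
        subw : w ⊆D C
        subw i lti bwi = subu i (≤-trans (bit-bound u i bu) (n≤1+n u)) bu
          where
          bu : bit u i ≡ 1
          bu = bit1-sound u i (imp-sound w i _ bwi (ALL-sound (lit 1 ⊞ v1) C4 (m' ∷ w ∷ e ∷ ctx4) call i lti))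

    Backed : ℕ → ℕ → Set
    Backed e b = Σ ℕ λ w → Σ ℕ λ m' → (w < b) × (m' < b) × (unpair m' ≡ (e , w)) × (1 ∸ fuelEval cD (b ∷ m' ∷ []) ≡ 0) × (w ⊆D C)

    Backed-mono : ∀ e b b' → b ≤ b' → Backed e b → Backed e b'
    Backed-mono e b b' le (w , m' , l1 , l2 , q1 , q2 , q3) = w , m' , ≤-trans l1 le , ≤-trans l2 le , q1 , fuelEval-halts-mono cD m' b b' le q2 , q3

    backed : ∀ {v} → v ⊆D B → ∀ e → e < suc v → bit v e ≡ 1 → Σ ℕ (Backed e)
    backed subv e lt be with proj₁ (eB e) (subv e lt be)
    ... | m' , d , e1' , subw with halts⇒fuelEval cD m' (proj₁ (hD m') d)
    ... | s' , hs' = suc (m' + proj₂ (unpair m') + s') , proj₂ (unpair m') , m' ,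
          s≤s (m≤n⇒m≤n+o s' (m≤n+m _ m')) , s≤s (m≤n⇒m≤n+o s' (m≤m+n m' _)) , cong (_, proj₂ (unpair m')) e1' ,
          fuelEval-halts-mono cD m' s' _ (≤-trans (m≤n+m s' _) (n≤1+n _)) hs' , subw

    -- The composite axiom ⟨x, D_u⟩ needs a finite u ⊆ C covering the Δ-axioms
    -- used for x; u is C cut off at a bound, which needs membership in C decided.
    module _ (em : ExcludedMiddle (Level.suc (Level.suc Level.zero))) where

      dC : ℕ → Bool
      dC i = does (em {Lift _ (C i)})

      dC→ : ∀ i → dC i ≡ true → C i
      dC→ i e with em {Lift _ (C i)}
      ... | yes (lift c) = c
      dC→ i () | no _

      dC← : ∀ i → C i → dC i ≡ true
      dC← i c with em {Lift _ (C i)}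
      ... | yes _ = refl
      ... | no ¬c = ⊥-elim (¬c (lift c))

      composite-complete : ∀ x → A x → applyOp (Σ₁ (prf P)) C x
      composite-complete x0 Ax with proj₁ (eA x0) Ax
      ... | m , g , e1 , subv with halts⇒fuelEval cG m (proj₁ (hG m) g)
      ... | sG , hsG with collect (λ e → bit (proj₂ (unpair m)) e ≡ 1) (λ e → bit (proj₂ (unpair m)) e ≟ 1)
                                 Backed Backed-mono (suc (proj₂ (unpair m))) (backed subv)
      ... | Bd , hB with unpair-surj x0 (fromB Bd dC)
      ... | n , en = n , (suc S , t) , cong proj₁ en , subst (_⊆D C) (sym (cong proj₂ en)) subu
        where
        v = proj₂ (unpair m)
        u = fromB Bd dC
        S = x0 + u + v + m + sG + Bd
        y = suc S
        L0 = y ∷ n ∷ []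
        ctx4 = m ∷ v ∷ u ∷ x0 ∷ L0
        subu : u ⊆D C
        subu i lt bi = dC→ i (proj₂ (bit-fromB Bd dC i bi))
        Bd≤ : Bd ≤ y
        Bd≤ = ≤-trans (m≤n+m Bd _) (n≤1+n _)
        allC1 : ∀ e → e < suc v → ⟦ C1 ⟧ (e ∷ ctx4) ≡ 0
        allC1 e lt = imp-comp v e _ λ be → lem (hB e lt be)
          where
          lem : _ → ⟦ EX (var (# 5)) C2 ⟧ (e ∷ ctx4) ≡ 0
          lem (w , m' , l1 , l2 , q1 , q2 , q3) =
            EX-comp (var (# 5)) C2 (e ∷ ctx4) w (≤-trans l1 Bd≤)
            (EX-comp (var (# 6)) C3 (w ∷ e ∷ ctx4) m' (≤-trans l2 Bd≤)
              (cong₂ _+_ (cong₂ _+_ (pair-comp m' e w q1) (fuelEval-halts-mono cD m' Bd y Bd≤ q2))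
                 (ALL-comp (lit 1 ⊞ v1) C4 (m' ∷ w ∷ e ∷ ctx4) λ i lti →
                    imp-comp w i _ λ bwi → bit1-comp u i (fromB-bit Bd dC i (≤-trans lti l1) (dC← i (q3 i lti bwi))))))
        t : ⟦ P ⟧ L0 ≡ 0
        t = EX-comp v0 B1 L0 x0 (s≤s (m≤n⇒m≤n+o Bd (m≤n⇒m≤n+o sG (m≤n⇒m≤n+o m (m≤n⇒m≤n+o v (m≤m+n x0 u))))))
             (EX-comp v1 B2 (x0 ∷ L0) u (s≤s (m≤n⇒m≤n+o Bd (m≤n⇒m≤n+o sG (m≤n⇒m≤n+o m (m≤n⇒m≤n+o v (m≤n+m u x0))))))
             (EX-comp v2 B3 (u ∷ x0 ∷ L0) v (s≤s (m≤n⇒m≤n+o Bd (m≤n⇒m≤n+o sG (m≤n⇒m≤n+o m (m≤n+m v (x0 + u))))))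
             (EX-comp (var (# 3)) B4 (v ∷ u ∷ x0 ∷ L0) m (s≤s (m≤n⇒m≤n+o Bd (m≤n⇒m≤n+o sG (m≤n+m m (x0 + u + v)))))
               (cong₂ _+_ (cong₂ _+_ (cong₂ _+_ (pair-comp n x0 u en) (pair-comp m x0 v (cong (_, v) e1)))
                   (fuelEval-halts-mono cG m sG y (≤-trans (m≤n⇒m≤n+o Bd (m≤n+m sG _)) (n≤1+n _)) hsG))
                  (ALL-comp (lit 1 ⊞ v1) C1 ctx4 allC1)))))

  ≤e-trans : ExcludedMiddle (Level.suc (Level.suc Level.zero)) → ∀ {A B C} → A ≤e B → B ≤e C → A ≤e C
  ≤e-trans em (Γ , (cG , hG) , eA) (Δ , (cD , hD) , eB) =
    Σ₁ (prf P) , Σ₁-CE (prf P) , λ x → composite-complete em x , composite-sound x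
    where open Composite cG cD hG hD eA eB


module Lattice (em : ExcludedMiddle (lsuc (lsuc lzero))) where

  open import Level using (lift; lower)
  open import Axiom.DoubleNegationElimination using (em⇒dne)
  open import Data.Nat using (ℕ; zero; suc)
  open import Data.Nat.Properties using (n<1+n)
  open import Data.Fin using (Fin; zero; suc)
  open import Data.Fin.Properties using (pigeonhole; <⇒≢; _≟_)
  open import Data.Fin.Permutation using (Permutation′; _⟨$⟩ʳ_; permutation)
  open import Data.Vec.Functional using (_∷_; tail; updateAt)
  open import Data.Vec.Functional.Properties using (updateAt-updates; updateAt-minimal)
  open import Data.Product using (Σ; _,_; proj₁; proj₂; _×_)
  open import Data.Empty using (⊥-elim)
  open import Function using (_∘_)
  open import Relation.Nullary using (Dec; yes; no; ¬_; contradiction)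
  open import Relation.Nullary.Decidable using (map′)
  open import Relation.Binary.PropositionalEquality using (_≡_; _≢_; refl; sym; trans; cong; subst)
  open ManyOne using (≤e-refl; ≤e-⊕l; ≤e-⊕r)
  open Join using (≤e-lub)

  ≤e-trans : ∀ {X Y Z} → X ≤e Y → Y ≤e Z → X ≤e Z
  ≤e-trans = Composition.≤e-trans em

  dne : {P : Set₁} → ¬ ¬ P → P
  dne = em⇒dne (map′ lower lift em)

  variable
    n m : ℕ
    A X X′ Y Y′ Z : SetΩ
    F G : Fin n → Family

  ⊕-mono : X ≤e X′ → Y ≤e Y′ → (X ⊕ Y) ≤e (X′ ⊕ Y′)
  ⊕-mono p q = ≤e-lub (≤e-trans p ≤e-⊕l) (≤e-trans q ≤e-⊕r)

  ⊕-comm : (X ⊕ Y) ≤e (Y ⊕ X)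
  ⊕-comm = ≤e-lub ≤e-⊕r ≤e-⊕l

  ⊕-idem : (X ⊕ X) ≤e X
  ⊕-idem = ≤e-lub ≤e-refl ≤e-refl

  ≤e-<e-trans : X ≤e Y → Y <e A → X <e A
  ≤e-<e-trans X≤Y (Y≤A , A≰Y) = ≤e-trans X≤Y Y≤A , λ A≤X → A≰Y (≤e-trans A≤X X≤Y)

  ⨁ : ∀ {k} → (Fin (suc k) → SetΩ) → SetΩ
  ⨁ {zero} Y = Y zero
  ⨁ {suc k} Y = Y zero ⊕ ⨁ (tail Y)

  ≤e-⨁ : ∀ {k} (Y : Fin (suc k) → SetΩ) j → Y j ≤e ⨁ Y
  ≤e-⨁ {zero} Y zero = ≤e-refl
  ≤e-⨁ {suc k} Y zero = ≤e-⊕l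
  ≤e-⨁ {suc k} Y (suc j) = ≤e-trans (≤e-⨁ (tail Y) j) ≤e-⊕r

  module _ {I : Family} (ideal : Ideal I) where
    open Ideal ideal

    Ideal-⊕ˡ : I (X ⊕ Y) → I X
    Ideal-⊕ˡ = downward _ _ ≤e-⊕l

    Ideal-⊕ʳ : I (X ⊕ Y) → I Y
    Ideal-⊕ʳ = downward _ _ ≤e-⊕r

    Ideal-⨁ : ∀ {k} (Y : Fin (suc k) → SetΩ) → (∀ j → I (Y j)) → I (⨁ Y)
    Ideal-⨁ {zero} Y IY = IY zero
    Ideal-⨁ {suc k} Y IY = join _ _ (IY zero) (Ideal-⨁ (tail Y) (IY ∘ suc))

  ⊆F-trans : {F G H : Family} → F ⊆F G → G ⊆F H → F ⊆F H
  ⊆F-trans F⊆G G⊆H X = G⊆H X ∘ F⊆G X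

  ¬⊆F⇒witness : {F G : Family} → ¬ F ⊆F G → Σ SetΩ λ X → F X × ¬ G X
  ¬⊆F⇒witness F⊈G = dne λ ¬wit → F⊈G λ X FX → dne λ ¬GX → ¬wit (X , FX , ¬GX)

  Proper : (Fin n → Family) → Set₁
  Proper F = ∀ i j → i ≢ j → ¬ (F i ⊆F F j)

  Proper-⊆⇒≡ : Proper F → ∀ {i j} → F i ⊆F F j → i ≡ j
  Proper-⊆⇒≡ proper {i} {j} Fi⊆Fj with i ≟ j
  ... | yes i≡j = i≡j
  ... | no i≢j = contradiction Fi⊆Fj (proper i j i≢j)

  module _ {F : Fin n → Family} {A} (cov : Covering n A F) where
    open Covering cov

    covered : Z <e A → Σ (Fin n) λ i → F i Z
    covered = proj₁ (covers _)

    member-<e : ∀ {i} → F i Z → Z <e A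
    member-<e {i = i} FiZ = proj₂ (covers _) (i , FiZ)

  ExclusiveMember : (Fin n → Family) → Fin n → SetΩ → Set₁
  ExclusiveMember F i X = F i X × (∀ j → j ≢ i → ¬ F j X)

  ExclusiveMember-unique : ∀ {i k} → ExclusiveMember F i X → F k X → k ≡ i
  ExclusiveMember-unique {i = i} {k} (_ , excl) FkX with k ≟ i
  ... | yes k≡i = k≡i
  ... | no k≢i = contradiction FkX (excl k k≢i)

  -- Join, over j ≢ i, a member of F i outside F j: it lies in F i and, since
  -- each F j is closed downward, in no other F j.
  exclusiveMember : ∀ {n} {F : Fin n → Family} → (∀ i → Ideal (F i)) → Proper F → ∀ i → Σ SetΩ (ExclusiveMember F i)
  exclusiveMember {suc _} {F} ideals proper i = ⨁ parts , Ideal-⨁ (ideals i) parts (proj₁ ∘ separate) , excl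
    where
    separator : ∀ j → Dec (j ≡ i) → Σ SetΩ λ X → F i X × (j ≢ i → ¬ F j X)
    separator j (yes j≡i) = let (X , FiX) = Ideal.nonempty (ideals i) in X , FiX , λ j≢i → ⊥-elim (j≢i j≡i)
    separator j (no j≢i) = let (X , FiX , ¬FjX) = ¬⊆F⇒witness (proper i j (j≢i ∘ sym)) in X , FiX , λ _ → ¬FjX

    parts : Fin _ → SetΩ
    parts j = proj₁ (separator j (j ≟ i))

    separate : ∀ j → F i (parts j) × (j ≢ i → ¬ F j (parts j))
    separate j = proj₂ (separator j (j ≟ i))

    excl : ∀ j → j ≢ i → ¬ F j (⨁ parts)
    excl j j≢i Fj⨁ = proj₂ (separate j) j≢i (Ideal.downward (ideals j) _ _ (≤e-⨁ parts j) Fj⨁)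

  -- Joining with X moves any Z ∈ G l into the same ideal of F as X.
  exclusive-⊆ : ∀ {i l} → Covering n A F → Covering m A G →
                ExclusiveMember F i X → G l X → G l ⊆F F i
  exclusive-⊆ {F = F} {G = G} {i = i} {l} covF covG exX GlX Z GlZ
    with covered covF (member-<e covG (Ideal.join (Covering.ideals covG l) _ _ GlZ GlX))
  ... | k , FkZ⊕X = subst (λ k → F k Z) (ExclusiveMember-unique {F = F} exX (Ideal-⊕ʳ (ideals k) FkZ⊕X)) (Ideal-⊕ˡ (ideals k) FkZ⊕X)
    where open Covering covF

  ProperCovering-match : ProperCovering n A F → ProperCovering m A G →
                         ∀ i → Σ (Fin m) λ l → F i ≐F G l
  ProperCovering-match {F = F} {G = G} (covF , properF) (covG , properG) i = l , Fi⊆Gl , Gl⊆Fi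
    where
    exF = exclusiveMember (Covering.ideals covF) properF i
    aInG = covered covG (member-<e covF (proj₁ (proj₂ exF)))
    l = proj₁ aInG
    Gl⊆Fi = exclusive-⊆ covF covG (proj₂ exF) (proj₂ aInG)
    exG = exclusiveMember (Covering.ideals covG) properG l
    Fi⊆Gl = exclusive-⊆ covG covF (proj₂ exG) (Gl⊆Fi _ (proj₁ (proj₂ exG)))

  ProperCovering-unique : ProperCovering n A F → ProperCovering n A G →
                          Σ (Permutation′ n) λ σ → ∀ i → F i ≐F G (σ ⟨$⟩ʳ i)
  ProperCovering-unique {F = F} {G = G} pcF pcG = σ , proj₂ ∘ matchF
    where
    matchF = ProperCovering-match pcF pcG
    matchG = ProperCovering-match pcG pcF
    τ = proj₁ ∘ matchF
    τ′ = proj₁ ∘ matchG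
    τ′∘τ : ∀ i → τ′ (τ i) ≡ i
    τ′∘τ i = Proper-⊆⇒≡ (proj₂ pcF) (⊆F-trans (proj₂ (proj₂ (matchG (τ i)))) (proj₂ (proj₂ (matchF i))))
    τ∘τ′ : ∀ l → τ (τ′ l) ≡ l
    τ∘τ′ l = Proper-⊆⇒≡ (proj₂ pcG) (⊆F-trans (proj₂ (proj₂ (matchF (τ′ l)))) (proj₂ (proj₂ (matchG l))))
    σ = permutation τ τ′ τ∘τ′ τ′∘τ

  Covering⇒JoinIrreducible : Covering n A F → JoinIrreducible n A
  Covering⇒JoinIrreducible {n = n} {F = F} cov As As<A
    with pigeonhole (n<1+n n) (proj₁ ∘ covered cov ∘ As<A)
  ... | i , j , i<j , same = i , j , <⇒≢ i<j ,
        member-<e cov (Ideal.join (Covering.ideals cov _) _ _ (proj₂ (covered cov (As<A i)))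
                         (subst (λ k → F k (As j)) (sym same) (proj₂ (covered cov (As<A j)))))

  -- Witnesses of join reducibility; since a i ⊕ a j ≤e A, the condition
  -- ¬ (a i ⊕ a j <e A) is the paper's a i ⊕ a j ≡e A.
  JoinSpanning : (n : ℕ) → SetΩ → (Fin n → SetΩ) → Set₁
  JoinSpanning n A a = (∀ i → a i <e A) × (∀ i j → i ≢ j → ¬ ((a i ⊕ a j) <e A))

  JoinSpanning⇒JoinReducible : ∀ {a} → JoinSpanning (suc m) A a → JoinReducible m A
  JoinSpanning⇒JoinReducible (a<A , spanning) irr =
    let (i , j , i≢j , ai⊕aj<A) = irr _ a<A in spanning i j i≢j ai⊕aj<A

  JoinReducible⇒JoinSpanning : JoinReducible m A → Σ (Fin (suc m) → SetΩ) (JoinSpanning (suc m) A)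
  JoinReducible⇒JoinSpanning red = dne λ ¬spanning → red λ As As<A → dne λ ¬pair →
    ¬spanning (As , As<A , λ i j i≢j lt → ¬pair (i , j , i≢j , lt))

  ProperCovering⇒JoinSpanning : ProperCovering n A F → Σ (Fin n → SetΩ) (JoinSpanning n A)
  ProperCovering⇒JoinSpanning {A = A} {F = F} (cov , proper) = a , member-<e cov ∘ Fa , spanning
    where
    ex = exclusiveMember (Covering.ideals cov) proper
    a = proj₁ ∘ ex
    Fa = proj₁ ∘ proj₂ ∘ ex
    spanning : ∀ i j → i ≢ j → ¬ ((a i ⊕ a j) <e A)
    spanning i j i≢j ai⊕aj<A with covered cov ai⊕aj<A
    ... | k , Fk = i≢j (trans (sym (ExclusiveMember-unique {F = F} (proj₂ (ex i)) (Ideal-⊕ˡ (Covering.ideals cov k) Fk)))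
                              (ExclusiveMember-unique {F = F} (proj₂ (ex j)) (Ideal-⊕ʳ (Covering.ideals cov k) Fk)))

  JoinSpanning-cover : ∀ {a} → JoinIrreducible n A → JoinSpanning n A a →
                       Z <e A → Σ (Fin n) λ i → (Z ⊕ a i) <e A
  JoinSpanning-cover {a = a} irr (a<A , spanning) Z<A with irr (_ ∷ a) (λ { zero → Z<A ; (suc i) → a<A i })
  ... | zero , zero , 0≢0 , _ = contradiction refl 0≢0
  ... | zero , suc j , _ , Z⊕aj<A = j , Z⊕aj<A
  ... | suc j , zero , _ , aj⊕Z<A = j , ≤e-<e-trans ⊕-comm aj⊕Z<A
  ... | suc j , suc k , j≢k , aj⊕ak<A = contradiction aj⊕ak<A (spanning j k (j≢k ∘ cong suc))

  module _ {a : Fin n → SetΩ} {i : Fin n} {Y : SetΩ} where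

    grow : Fin n → SetΩ
    grow = updateAt a i (Y ⊕_)

    grow-at : grow i ≡ Y ⊕ a i
    grow-at = updateAt-updates i a

    grow-other : ∀ {j} → j ≢ i → grow j ≡ a j
    grow-other j≢i = updateAt-minimal _ i a j≢i

    ≤e-grow : ∀ j → a j ≤e grow j
    ≤e-grow j with j ≟ i
    ... | yes refl = subst (_ ≤e_) (sym grow-at) ≤e-⊕r
    ... | no j≢i = subst (_ ≤e_) (sym (grow-other j≢i)) ≤e-refl

    JoinSpanning-grow : ∀ {A} → JoinSpanning n A a → (Y ⊕ a i) <e A → JoinSpanning n A grow
    JoinSpanning-grow {A} (a<A , spanning) Y⊕ai<A = grow<A , grow-spanning
      where
      grow<A : ∀ j → grow j <e A
      grow<A j with j ≟ i
      ... | yes refl = subst (_<e A) (sym grow-at) Y⊕ai<A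
      ... | no j≢i = subst (_<e A) (sym (grow-other j≢i)) (a<A j)

      grow-spanning : ∀ j k → j ≢ k → ¬ ((grow j ⊕ grow k) <e A)
      grow-spanning j k j≢k = spanning j k j≢k ∘ ≤e-<e-trans (⊕-mono (≤e-grow j) (≤e-grow k))

    JoinSpanning-grow-⊕ : ∀ {A X} → JoinSpanning n A a → ∀ j → Dec (j ≡ i) →
                          ((X ⊕ a i) ⊕ grow j) <e A → ((X ⊕ Y) ⊕ a i) <e A
    JoinSpanning-grow-⊕ {A} {X} _ j (yes j≡i) lt =
      ≤e-<e-trans (≤e-lub (⊕-mono ≤e-⊕l ≤e-⊕l) (≤e-trans ≤e-⊕r ≤e-⊕l))
                  (subst (λ W → ((X ⊕ a i) ⊕ W) <e A) (trans (cong grow j≡i) grow-at) lt)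
    JoinSpanning-grow-⊕ {A} {X} (_ , spanning) j (no j≢i) lt =
      contradiction (≤e-<e-trans (⊕-mono ≤e-⊕r ≤e-refl) (subst (λ W → ((X ⊕ a i) ⊕ W) <e A) (grow-other j≢i) lt))
                    (spanning i j (j≢i ∘ sym))

  -- The ideals are F i = {Z | Z ⊕ a i <e A}; for closure under ⊕, covering
  -- X ⊕ a i by the family a with a i enlarged to Y ⊕ a i can only use index i.
  JoinSpanning⇒ProperCovering : ∀ {a} → JoinIrreducible n A → JoinSpanning n A a →
                                ProperCovering n A (λ i Z → (Z ⊕ a i) <e A)
  JoinSpanning⇒ProperCovering {A = A} {a = a} irr sp@(a<A , spanning) =
    record { ideals = ideal ; covers = λ Z → JoinSpanning-cover irr sp , λ (_ , lt) → ≤e-<e-trans ≤e-⊕l lt } ,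
    proper
    where
    ai∈Fi : ∀ i → (a i ⊕ a i) <e A
    ai∈Fi i = ≤e-<e-trans ⊕-idem (a<A i)

    join-closed : ∀ i X Y → (X ⊕ a i) <e A → (Y ⊕ a i) <e A → ((X ⊕ Y) ⊕ a i) <e A
    join-closed i X Y X⊕ai<A Y⊕ai<A =
      let (j , lt) = JoinSpanning-cover irr (JoinSpanning-grow {i = i} sp Y⊕ai<A) X⊕ai<A
      in JoinSpanning-grow-⊕ sp j (j ≟ i) lt

    ideal : ∀ i → Ideal (λ Z → (Z ⊕ a i) <e A)
    ideal i = record
      { nonempty = a i , ai∈Fi i
      ; downward = λ _ _ X≤Y → ≤e-<e-trans (⊕-mono X≤Y ≤e-refl)
      ; join = join-closed i
      }

    proper : Proper (λ i Z → (Z ⊕ a i) <e A)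
    proper i j i≢j Fi⊆Fj = spanning i j i≢j (Fi⊆Fj (a i) (ai∈Fi i))

theorem4p8 : ExcludedMiddle (lsuc (lsuc lzero)) →
    (n : ℕ) → 1 ≤ n → (A : SetΩ) →
    (HasUniqueProperCovering n A ⇔ HasProperCovering n A) ×
    (HasProperCovering n A ⇔ (JoinIrreducible n A × JoinReducible (n ∸ 1) A))
theorem4p8 em (suc _) _ A =
  mk⇔ proj₁ (λ hasPC → hasPC , λ _ _ → ProperCovering-unique) ,
  mk⇔ (λ (_ , pc) → Covering⇒JoinIrreducible (proj₁ pc) , JoinSpanning⇒JoinReducible (proj₂ (ProperCovering⇒JoinSpanning pc)))
      (λ (irr , red) → _ , JoinSpanning⇒ProperCovering irr (proj₂ (JoinReducible⇒JoinSpanning red)))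
  where open Lattice em
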